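{- Let $q$ be an odd prime power and $m>1$ an integer with $m\mid q+1$. Define $\psi:\mathbb{F}_{q^2}\to\mathbb{F}_{q^2}$ by $\psi(\gamma)=\frac{\alpha\gamma+d}{\gamma-\alpha}$ for $\gamma\ne\alpha$ and $\psi(\alpha)=\alpha$. Let $c_1,\dots,c_{\frac{q+1-m}{m}}$ be the points where the line $\mathbb{F}_q$ meets the $m$-ary lines through $\alpha$ other than the line $\{c+\alpha:c\in\mathbb{F}_q\}$. If $m\nmid\frac{q+1}{2}$, then $\psi(\alpha Q_0)=\{\alpha,c_1,\dots,c_{\frac{q+1-m}{m}}\}$, a clique of size $\frac{q+1}{m}$ in $\mathrm{GP}(q^2,m)$. If $m\mid\frac{q+1}{2}$, then $\psi(\{0\}\cup\alpha Q_0)=\{\pm\alpha,c_1,\dots,c_{\frac{q+1-m}{m}}\}$, a clique of size $\frac{q+1+m}{m}$ in $\mathrm{GP}(q^2,m)$.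
   Context: The generalised Paley graph $\mathrm{GP}(q^2,m)$ has vertex set $\mathbb{F}_{q^2}$, with two distinct vertices $x,y$ adjacent iff $x-y$ is an $m$-th power of an element of $\mathbb{F}_{q^2}^*$. Fix a non-square $d\in\mathbb{F}_q^*$ and $\alpha\in\mathbb{F}_{q^2}$ with $\alpha^2=d$, so $\mathbb{F}_{q^2}=\{x+y\alpha:x,y\in\mathbb{F}_q\}$ is viewed as the affine plane $AG(2,q)$. A line is a set $\{a+cs:c\in\mathbb{F}_q\}$ with $a\in\mathbb{F}_{q^2}$, $s\in\mathbb{F}_{q^2}^*$; it is $m$-ary if its slope $s$ is an $m$-th power in $\mathbb{F}_{q^2}^*$. Fix a primitive element $\beta$ of $\mathbb{F}_{q^2}$, let $\omega=\beta^{q-1}$, $Q_0=\langle\omega^m\rangle$ and $\alpha Q_0=\{\alpha\gamma:\gamma\in Q_0\}$. -}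

module Defs where

open import Level using (0ℓ)
open import Algebra.Bundles using (CommutativeRing)
open import Data.Nat as ℕ using (ℕ; zero; suc)
open import Data.Nat.Primality using (Prime)
open import Data.Fin using (Fin)
open import Data.Product using (Σ; ∃; _×_; _,_)
open import Data.Sum using (_⊎_)
open import Relation.Nullary using (¬_; yes; no)
open import Relation.Binary.Definitions using (Decidable)
open import Relation.Binary.PropositionalEquality using (_≡_)

OddPrimePower : ℕ → Set
OddPrimePower q = Σ ℕ λ p → Σ ℕ λ k → Prime p × ¬ (p ≡ 2) × q ≡ p ℕ.^ suc k

record IsFiniteFieldOfSize (R : CommutativeRing 0ℓ 0ℓ) (n : ℕ) : Set where
  open CommutativeRing R
  field
    _≟_     : Decidable _≈_
    1≉0     : ¬ (1# ≈ 0#)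
    inv     : Carrier → Carrier
    inv-r   : ∀ x → ¬ (x ≈ 0#) → (x * inv x) ≈ 1#
    enum    : Fin n → Carrier
    enum-inj : ∀ i j → enum i ≈ enum j → i ≡ j
    enum-surj : ∀ x → ∃ λ i → enum i ≈ x

module FieldNotions (R : CommutativeRing 0ℓ 0ℓ) where
  open CommutativeRing R

  pow : Carrier → ℕ → Carrier
  pow x zero    = 1#
  pow x (suc n) = x * pow x n

  IsPower : ℕ → Carrier → Set
  IsPower m x = ∃ λ y → ¬ (y ≈ 0#) × pow y m ≈ x

  InFq : ℕ → Carrier → Set
  InFq q x = pow x q ≈ x

  IsPrimitive : ℕ → Carrier → Set
  IsPrimitive N β = pow β (N ℕ.∸ 1) ≈ 1#
                  × (∀ k → 0 ℕ.< k → k ℕ.< N ℕ.∸ 1 → ¬ (pow β k ≈ 1#))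

  OnLine : ℕ → Carrier → Carrier → Carrier → Set
  OnLine q a s z = ∃ λ c → InFq q c × z ≈ a + c * s

  SameLine : ℕ → Carrier → Carrier → Carrier → Carrier → Set
  SameLine q a s a' s' = ∀ z → (OnLine q a s z → OnLine q a' s' z)
                                × (OnLine q a' s' z → OnLine q a s z)

  -- the points c_i: points of the line F_q (= line {0 + c·1}) lying on some
  -- m-ary line through α other than the line {c + α : c ∈ F_q} (= line (α,1))
  IsCPoint : ℕ → ℕ → Carrier → Carrier → Set
  IsCPoint q m α x =
    OnLine q 0# 1# x ×
    (∃ λ a → ∃ λ s → ¬ (s ≈ 0#) × IsPower m s × OnLine q a s α
       × ¬ SameLine q a s α 1# × OnLine q a s x)

  -- clique in GP(q^2, m): distinct members differ by an m-th power
  IsClique : ℕ → (Carrier → Set) → Set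
  IsClique m S = ∀ x y → S x → S y → ¬ (x ≈ y) → IsPower m (x - y)

  HasSize : ℕ → (Carrier → Set) → Set
  HasSize k S = Σ (Fin k → Carrier) λ e →
      (∀ i j → e i ≈ e j → i ≡ j) × (∀ x → (S x → ∃ λ i → e i ≈ x) × ((∃ λ i → e i ≈ x) → S x))

  -- Q0 = ⟨ ω^m ⟩ with ω = β^(q-1)
  InQ0 : ℕ → ℕ → Carrier → Carrier → Set
  InQ0 q m β γ = ∃ λ k → γ ≈ pow (pow (pow β (q ℕ.∸ 1)) m) k

  Image : (Carrier → Carrier) → (Carrier → Set) → Carrier → Set
  Image f S y = ∃ λ x → S x × f x ≈ y

  SetEq : (Carrier → Set) → (Carrier → Set) → Set
  SetEq S T = ∀ y → (S y → T y) × (T y → S y)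

  module Psi (_≟_ : Decidable _≈_) (inv : Carrier → Carrier) (α d : Carrier) where
    ψ : Carrier → Carrier
    ψ γ with γ ≟ α
    ... | yes _ = α
    ... | no  _ = (α * γ + d) * inv (γ - α)

-- ψ sends αγ to the x with (x − α)γ = x + α.  For γ ∈ Q0 we have γ^k = 1 and γ^(q+1) = 1, so
-- applying the Frobenius x ↦ x^q, which fixes F_q and sends α to −α, shows that x^q satisfies the
-- same relation as x; hence x ∈ F_q, and then γ = (x − α)^(q−1).  As (q² − 1)/m = (q − 1)k with
-- k = (q + 1)/m, the condition γ^k = 1 says precisely that x − α is an m-th power, i.e. that x
-- lies on an m-ary line through α; conversely every such x arises from γ = (x − α)^(q−1), while
-- γ = 1 gives ψ(α) = α.  These points form a clique because F_q^* consists of m-th powers and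
-- x + α = (x − α)^q.  When k is even, α^((q²−1)/m) = (−1)^k = 1 makes 2α an m-th power, so
-- −α = ψ(0) joins the clique.

module Submission where

open import Level using (Level; 0ℓ)
open import Algebra.Bundles using (CommutativeRing)
open import Algebra.Solver.Ring.AlmostCommutativeRing
  using (AlmostCommutativeRing; _-Raw-AlmostCommutative⟶_; fromCommutativeRing)
open import Data.Nat as ℕ using (ℕ; zero; suc; _<_; _≤_; z≤n; s≤s; NonZero; _!)
import Data.Nat.Properties as ℕ
open import Data.Nat.DivMod using (_%_; _/_; m≡m%n+[m/n]*n; m%n<n; m/n*n≡m; m*n/n≡m)
open import Data.Nat.Divisibility
  using (_∣_; divides; ∣⇒≤; ∣1⇒≡1; m∣m*n; m%n≡0⇒n∣m; *-cancelˡ-∣)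
open import Data.Nat.Primality using (Prime; euclidsLemma; prime⇒irreducible; ¬prime[0]; ¬prime[1])
open import Data.Nat.Combinatorics using (_C_; nCk≡n!/k![n-k]!; k![n∸k]!∣n!; nCn≡1)
open import Data.Nat.Tactic.RingSolver using (solve-∀)
open import Data.Integer as ℤ using (ℤ; +_; -[1+_]; _⊖_)
import Data.Integer.Properties as ℤ
open import Data.Sign as Sign using (Sign)
open import Data.Maybe using (Maybe; just; nothing)
open import Data.Fin as Fin using (Fin; toℕ; fromℕ; fromℕ<; inject₁)
import Data.Fin.Properties as Fin
open import Data.Fin.Permutation using (permutation)
open import Data.Product using (∃; _,_; proj₁; proj₂)
open import Data.Sum using (_⊎_; inj₁; inj₂)
open import Data.Empty using (⊥-elim)
open import Function using (_∘_; _⇔_; mk⇔; Equivalence)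
open import Relation.Nullary using (¬_; yes; no; Dec)
open import Relation.Binary.Definitions using (Decidable)
open import Relation.Binary.PropositionalEquality as ≡ using (_≡_; _≢_)
open import Defs

-- Normal forms are compared by evaluation, which works for integer coefficients but not for the
-- elements of an abstract ring.
module IntegerCoefficientRingSolver {c ℓ : Level} (R : CommutativeRing c ℓ) where
  open CommutativeRing R
  open import Algebra.Properties.Ring ring using (-0#≈0#; -‿distribˡ-*; -‿distribʳ-*; -‿involutive)
  open import Algebra.Properties.AbelianGroup +-abelianGroup using (⁻¹-∙-comm)
  open import Algebra.Properties.Semiring.Mult.TCOptimised semiring
  open import Relation.Binary.Reasoning.Setoid setoid

  fromℤ : ℤ → Carrier
  fromℤ (+ n)    = n × 1#
  fromℤ -[1+ n ] = - (suc n × 1#)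

  private
    sub-+1 : ∀ a b → (1# + a) - (1# + b) ≈ a - b
    sub-+1 a b = begin
      (1# + a) + - (1# + b)   ≈⟨ +-congˡ (sym (⁻¹-∙-comm 1# b)) ⟩
      (1# + a) + (- 1# + - b) ≈⟨ +-assoc 1# a _ ⟩
      1# + (a + (- 1# + - b)) ≈⟨ +-congˡ (+-comm a _) ⟩
      1# + ((- 1# + - b) + a) ≈⟨ +-congˡ (+-assoc (- 1#) (- b) a) ⟩
      1# + (- 1# + (- b + a)) ≈⟨ sym (+-assoc 1# (- 1#) _) ⟩
      (1# - 1#) + (- b + a)   ≈⟨ +-cong (-‿inverseʳ 1#) (+-comm (- b) a) ⟩
      0# + (a - b)            ≈⟨ +-identityˡ _ ⟩
      a - b                   ∎

  fromℤ-⊖ : ∀ m n → fromℤ (m ⊖ n) ≈ m × 1# - n × 1#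
  fromℤ-⊖ m       zero    = sym (trans (+-congˡ -0#≈0#) (+-identityʳ _))
  fromℤ-⊖ zero    (suc n) = sym (+-identityˡ _)
  fromℤ-⊖ (suc m) (suc n) rewrite ℤ.[1+m]⊖[1+n]≡m⊖n m n = begin
    fromℤ (m ⊖ n)                       ≈⟨ fromℤ-⊖ m n ⟩
    m × 1# - n × 1#                     ≈⟨ sym (sub-+1 (m × 1#) (n × 1#)) ⟩
    (1# + m × 1#) - (1# + n × 1#)       ≈⟨ sym (+-cong (×-homo-+ 1# 1 m) (-‿cong (×-homo-+ 1# 1 n))) ⟩
    suc m × 1# - suc n × 1#             ∎

  fromℤ-+ : ∀ i j → fromℤ (i ℤ.+ j) ≈ fromℤ i + fromℤ j
  fromℤ-+ (+ a)    (+ b)    = ×-homo-+ 1# a b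
  fromℤ-+ (+ a)    -[1+ b ] = fromℤ-⊖ a (suc b)
  fromℤ-+ -[1+ a ] (+ b)    = trans (fromℤ-⊖ b (suc a)) (+-comm _ _)
  fromℤ-+ -[1+ a ] -[1+ b ] = begin
    - (suc (suc (a ℕ.+ b)) × 1#) ≈⟨ -‿cong (×-cong (≡.sym (ℕ.+-suc (suc a) b)) refl) ⟩
    - ((suc a ℕ.+ suc b) × 1#)   ≈⟨ -‿cong (×-homo-+ 1# (suc a) (suc b)) ⟩
    - (suc a × 1# + suc b × 1#)  ≈⟨ sym (⁻¹-∙-comm _ _) ⟩
    - (suc a × 1#) + - (suc b × 1#) ∎

  fromℤ-neg : ∀ i → fromℤ (ℤ.- i) ≈ - fromℤ i
  fromℤ-neg (+ zero)  = sym -0#≈0#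
  fromℤ-neg (+ suc n) = refl
  fromℤ-neg -[1+ n ]  = sym (-‿involutive _)

  private
    signed : Sign → Carrier → Carrier
    signed Sign.+ x = x
    signed Sign.- x = - x

    fromℤ-◃ : ∀ s n → fromℤ (s ℤ.◃ n) ≈ signed s (n × 1#)
    fromℤ-◃ Sign.+ zero    = refl
    fromℤ-◃ Sign.+ (suc n) = refl
    fromℤ-◃ Sign.- zero    = sym -0#≈0#
    fromℤ-◃ Sign.- (suc n) = refl

    -x*-y≈x*y : ∀ x y → - x * - y ≈ x * y
    -x*-y≈x*y x y = begin
      - x * - y   ≈⟨ sym (-‿distribˡ-* x (- y)) ⟩
      - (x * - y) ≈⟨ -‿cong (sym (-‿distribʳ-* x y)) ⟩
      - - (x * y) ≈⟨ -‿involutive _ ⟩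
      x * y       ∎

  fromℤ-* : ∀ i j → fromℤ (i ℤ.* j) ≈ fromℤ i * fromℤ j
  fromℤ-* (+ a) (+ b) =
    trans (fromℤ-◃ Sign.+ (a ℕ.* b)) (×1-homo-* a b)
  fromℤ-* (+ a) -[1+ b ] =
    trans (fromℤ-◃ Sign.- (a ℕ.* suc b)) (trans (-‿cong (×1-homo-* a (suc b))) (-‿distribʳ-* _ _))
  fromℤ-* -[1+ a ] (+ b) =
    trans (fromℤ-◃ Sign.- (suc a ℕ.* b)) (trans (-‿cong (×1-homo-* (suc a) b)) (-‿distribˡ-* _ _))
  fromℤ-* -[1+ a ] -[1+ b ] =
    trans (fromℤ-◃ Sign.+ (suc a ℕ.* suc b)) (trans (×1-homo-* (suc a) (suc b)) (sym (-x*-y≈x*y _ _)))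

  private
    R′ : AlmostCommutativeRing c ℓ
    R′ = fromCommutativeRing R

    fromℤ-homomorphism : ℤ.+-*-rawRing -Raw-AlmostCommutative⟶ R′
    fromℤ-homomorphism = record
      { ⟦_⟧ = fromℤ ; +-homo = fromℤ-+ ; *-homo = fromℤ-* ; -‿homo = fromℤ-neg
      ; 0-homo = refl ; 1-homo = refl }

    fromℤ-≟ : ∀ a b → Maybe (fromℤ a ≈ fromℤ b)
    fromℤ-≟ a b with a ℤ.≟ b
    ... | yes ≡.refl = just refl
    ... | no _       = nothing

  open import Algebra.Solver.Ring ℤ.+-*-rawRing R′ fromℤ-homomorphism fromℤ-≟ public

Odd : ℕ → Set
Odd n = ∃ λ t → n ≡ suc (t ℕ.* 2)

odd-* : ∀ {a b} → Odd a → Odd b → Odd (a ℕ.* b)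
odd-* (s , ≡.refl) (t , ≡.refl) = s ℕ.+ t ℕ.+ s ℕ.* t ℕ.* 2 , expand s t
  where
  expand : ∀ s t → suc (s ℕ.* 2) ℕ.* suc (t ℕ.* 2) ≡ suc ((s ℕ.+ t ℕ.+ s ℕ.* t ℕ.* 2) ℕ.* 2)
  expand = solve-∀

odd-^ : ∀ {a} → Odd a → ∀ e → Odd (a ℕ.^ e)
odd-^ a-odd zero    = 0 , ≡.refl
odd-^ a-odd (suc e) = odd-* a-odd (odd-^ a-odd e)

prime≢2⇒odd : ∀ {p} → Prime p → p ≢ 2 → Odd p
prime≢2⇒odd {p} p-prime p≢2 with p % 2 in p%2≡r | m%n<n p 2
... | zero | _ with prime⇒irreducible p-prime (m%n≡0⇒n∣m p 2 p%2≡r)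
...   | inj₁ ()
...   | inj₂ 2≡p = ⊥-elim (p≢2 (≡.sym 2≡p))
prime≢2⇒odd {p} p-prime p≢2 | suc zero | _ =
  p / 2 , ≡.trans (m≡m%n+[m/n]*n p 2) (≡.cong (ℕ._+ (p / 2) ℕ.* 2) p%2≡r)
prime≢2⇒odd {p} p-prime p≢2 | suc (suc _) | ℕ.s≤s (ℕ.s≤s ())

p∤j! : ∀ {p j} → Prime p → j < p → ¬ p ∣ j !
p∤j! {j = zero}  p-prime _   p∣1 = ¬prime[1] (≡.subst Prime (∣1⇒≡1 p∣1) p-prime)
p∤j! {j = suc j} p-prime j<p p∣j! with euclidsLemma (suc j) (j !) p-prime p∣j!
... | inj₁ p∣1+j = ℕ.<⇒≱ j<p (∣⇒≤ p∣1+j)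
... | inj₂ p∣j!  = p∤j! p-prime (ℕ.<-trans (ℕ.n<1+n j) j<p) p∣j!

p∣p! : ∀ {p} → Prime p → p ∣ p !
p∣p! {zero}  p-prime = ⊥-elim (¬prime[0] p-prime)
p∣p! {suc n} _       = m∣m*n (n !)

p∣pCk : ∀ {p k} → Prime p → 0 < k → k < p → p ∣ p C k
p∣pCk {p} {k} p-prime 0<k k<p
  with euclidsLemma (p C k) (k ! ℕ.* (p ℕ.∸ k) !) p-prime p∣pCk*k![p-k]!
  where
  p∣pCk*k![p-k]! : p ∣ (p C k) ℕ.* (k ! ℕ.* (p ℕ.∸ k) !)
  p∣pCk*k![p-k]! = ≡.subst (p ∣_) (≡.sym (≡.trans
    (≡.cong (ℕ._* (k ! ℕ.* (p ℕ.∸ k) !)) (nCk≡n!/k![n-k]! (ℕ.<⇒≤ k<p)))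
    (m/n*n≡m {{ℕ._!*_!≢0 k (p ℕ.∸ k)}} (k![n∸k]!∣n! (ℕ.<⇒≤ k<p))))) (p∣p! p-prime)
... | inj₁ p∣pCk = p∣pCk
... | inj₂ p∣k!*[p-k]! with euclidsLemma (k !) ((p ℕ.∸ k) !) p-prime p∣k!*[p-k]!
...   | inj₁ p∣k!     = ⊥-elim (p∤j! p-prime k<p p∣k!)
...   | inj₂ p∣[p-k]! = ⊥-elim (p∤j! p-prime (ℕ.∸-monoʳ-< 0<k (ℕ.<⇒≤ k<p)) p∣[p-k]!)

module Powers (R : CommutativeRing 0ℓ 0ℓ) where
  open CommutativeRing R
  open FieldNotions R
  open import Algebra.Properties.Semiring.Exp semiring
  open import Algebra.Properties.CommutativeSemiring.Exp commutativeSemiring using (^-distrib-*)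

  pow≡^ : ∀ x n → pow x n ≡ x ^ n
  pow≡^ x zero    = ≡.refl
  pow≡^ x (suc n) = ≡.cong (x *_) (pow≡^ x n)

  pow-congˡ : ∀ {x y} n → x ≈ y → pow x n ≈ pow y n
  pow-congˡ {x} {y} n x≈y rewrite pow≡^ x n | pow≡^ y n = ^-congˡ n x≈y

  pow-homo-* : ∀ x m n → pow x (m ℕ.+ n) ≈ pow x m * pow x n
  pow-homo-* x m n rewrite pow≡^ x (m ℕ.+ n) | pow≡^ x m | pow≡^ x n = ^-homo-* x m n

  pow-assocʳ : ∀ x m n → pow (pow x m) n ≈ pow x (m ℕ.* n)
  pow-assocʳ x m n rewrite pow≡^ (pow x m) n | pow≡^ x m | pow≡^ x (m ℕ.* n) = ^-assocʳ x m n

  pow-distrib-* : ∀ x y n → pow (x * y) n ≈ pow x n * pow y n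
  pow-distrib-* x y n rewrite pow≡^ (x * y) n | pow≡^ x n | pow≡^ y n = ^-distrib-* x y n

  pow-1# : ∀ n → pow 1# n ≈ 1#
  pow-1# zero    = refl
  pow-1# (suc n) = trans (*-identityˡ _) (pow-1# n)

  pow≈1⇒pow-*≈1 : ∀ {x} m n → pow x m ≈ 1# → pow x (m ℕ.* n) ≈ 1#
  pow≈1⇒pow-*≈1 {x} m n xᵐ≈1 = trans (sym (pow-assocʳ x m n)) (trans (pow-congˡ n xᵐ≈1) (pow-1# n))

module Frobenius (R : CommutativeRing 0ℓ 0ℓ) where
  open CommutativeRing R
  open FieldNotions R
  open Powers R
  open import Algebra.Properties.Semiring.Mult semiring
  open import Algebra.Properties.Semiring.Exp semiring using (_^_)
  open import Algebra.Properties.CommutativeSemiring.Binomial commutativeSemiring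
  open import Algebra.Properties.Semiring.Sum semiring using (sum; sum-cong-≋; sum-init-last; sum-replicate-zero)
  open import Relation.Binary.Reasoning.Setoid setoid

  multiple×≈0 : ∀ {p} → p × 1# ≈ 0# → ∀ {c} x → p ∣ c → c × x ≈ 0#
  multiple×≈0 {p} p×1≈0 x (divides t ≡.refl) = begin
    (t ℕ.* p) × x      ≈⟨ ×-congˡ (ℕ.*-comm t p) ⟩
    (p ℕ.* t) × x      ≈⟨ sym (×-assocˡ x p t) ⟩
    p × (t × x)        ≈⟨ ×-congʳ p (sym (*-identityˡ _)) ⟩
    p × (1# * (t × x)) ≈⟨ sym (×-assoc-* p 1# _) ⟩
    (p × 1#) * (t × x) ≈⟨ *-congʳ p×1≈0 ⟩
    0# * (t × x)       ≈⟨ zeroˡ _ ⟩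
    0#                 ∎

  private
    sum-outer : ∀ n (f : Fin (suc (suc n)) → Carrier) → (∀ (i : Fin n) → f (Fin.suc (inject₁ i)) ≈ 0#) →
                sum f ≈ f Fin.zero + f (fromℕ (suc n))
    sum-outer n f inner≈0 = +-congˡ (begin
      sum (f ∘ Fin.suc)                                  ≈⟨ sum-init-last (f ∘ Fin.suc) ⟩
      sum (f ∘ Fin.suc ∘ inject₁) + f (fromℕ (suc n))    ≈⟨ +-congʳ (sum-cong-≋ inner≈0) ⟩
      sum {n} (λ _ → 0#) + f (fromℕ (suc n))             ≈⟨ +-congʳ (sum-replicate-zero n) ⟩
      0# + f (fromℕ (suc n))                             ≈⟨ +-identityˡ _ ⟩
      f (fromℕ (suc n))                                  ∎)

    pow≈^ : ∀ x n → pow x n ≈ x ^ n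
    pow≈^ x n = reflexive (pow≡^ x n)

    last-binomialTerm : ∀ {x y} n → binomialTerm x y n (fromℕ n) ≈ x ^ n
    last-binomialTerm n rewrite Fin.toℕ-fromℕ n | nCn≡1 n | ℕ.n∸n≡0 n =
      trans (×-homo-1 _) (*-identityʳ _)

  frobenius : ∀ {p} → Prime p → p × 1# ≈ 0# → ∀ x y → pow (x + y) p ≈ pow x p + pow y p
  frobenius {zero} p-prime = ⊥-elim (¬prime[0] p-prime)
  frobenius {suc n} p-prime p×1≈0 x y = begin
    pow (x + y) p                                          ≈⟨ pow≈^ (x + y) p ⟩
    (x + y) ^ p                                            ≈⟨ theorem p x y ⟩
    binomialExpansion x y p                                ≈⟨ sum-outer n (binomialTerm x y p) inner≈0 ⟩
    binomialTerm x y p Fin.zero + binomialTerm x y p (fromℕ p) ≈⟨ +-comm _ _ ⟩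
    binomialTerm x y p (fromℕ p) + binomialTerm x y p Fin.zero ≈⟨ +-cong last≈xᵖ first≈yᵖ ⟩
    pow x p + pow y p                                      ∎
    where
    p = suc n
    inner≈0 : ∀ (i : Fin n) → binomialTerm x y p (Fin.suc (inject₁ i)) ≈ 0#
    inner≈0 i = multiple×≈0 p×1≈0 _ (p∣pCk p-prime (s≤s z≤n)
      (≡.subst (_< p) (≡.sym (≡.cong suc (Fin.toℕ-inject₁ i))) (s≤s (Fin.toℕ<n i))))
    first≈yᵖ : binomialTerm x y p Fin.zero ≈ pow y p
    first≈yᵖ = trans (×-homo-1 _) (trans (*-identityˡ _) (sym (pow≈^ y p)))
    last≈xᵖ : binomialTerm x y p (fromℕ p) ≈ pow x p
    last≈xᵖ = trans (last-binomialTerm p) (sym (pow≈^ x p))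

  frobenius-^ : ∀ {p} → Prime p → p × 1# ≈ 0# → ∀ e x y →
                pow (x + y) (p ℕ.^ e) ≈ pow x (p ℕ.^ e) + pow y (p ℕ.^ e)
  frobenius-^ p-prime p×1≈0 zero x y =
    trans (*-identityʳ _) (sym (+-cong (*-identityʳ _) (*-identityʳ _)))
  frobenius-^ {p} p-prime p×1≈0 (suc e) x y = begin
    pow (x + y) (p ℕ.* p ℕ.^ e)                       ≈⟨ sym (pow-assocʳ (x + y) p (p ℕ.^ e)) ⟩
    pow (pow (x + y) p) (p ℕ.^ e)                     ≈⟨ pow-congˡ (p ℕ.^ e) (frobenius p-prime p×1≈0 x y) ⟩
    pow (pow x p + pow y p) (p ℕ.^ e)                 ≈⟨ frobenius-^ p-prime p×1≈0 e _ _ ⟩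
    pow (pow x p) (p ℕ.^ e) + pow (pow y p) (p ℕ.^ e) ≈⟨ +-cong (pow-assocʳ x p (p ℕ.^ e)) (pow-assocʳ y p (p ℕ.^ e)) ⟩
    pow x (p ℕ.* p ℕ.^ e) + pow y (p ℕ.* p ℕ.^ e)     ∎

module Cardinality (R : CommutativeRing 0ℓ 0ℓ) where
  open CommutativeRing R
  open FieldNotions R

  HasSize-SetEq : ∀ {n S T} → SetEq S T → HasSize n S → HasSize n T
  HasSize-SetEq S≐T (e , e-injective , e-onto) =
    e , e-injective , λ x → (λ Tx → proj₁ (e-onto x) (proj₂ (S≐T x) Tx)) ,
                            (λ hit → proj₁ (S≐T x) (proj₂ (e-onto x) hit))

  HasSize-Image : ∀ {n S} {f : Carrier → Carrier} → (∀ {x y} → x ≈ y → f x ≈ f y) →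
                  (∀ {x y} → f x ≈ f y → x ≈ y) → HasSize n S → HasSize n (Image f S)
  HasSize-Image {f = f} f-cong f-injective (e , e-injective , e-onto) =
    (λ i → f (e i)) ,
    (λ i j feᵢ≈feⱼ → e-injective i j (f-injective feᵢ≈feⱼ)) ,
    λ y → (λ { (x , Sx , fx≈y) → let (i , eᵢ≈x) = proj₁ (e-onto x) Sx in i , trans (f-cong eᵢ≈x) fx≈y }) ,
          (λ { (i , feᵢ≈y) → e i , proj₂ (e-onto (e i)) (i , refl) , feᵢ≈y })

  HasSize-insert : ∀ {n S} x → (∀ z → S z → ¬ z ≈ x) → HasSize n S → HasSize (suc n) (λ z → z ≈ x ⊎ S z)
  HasSize-insert {n} {S} x S∌x (e , e-injective , e-onto) = e′ , e′-injective , λ y → onto y , into y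
    where
    e′ : Fin (suc n) → Carrier
    e′ Fin.zero    = x
    e′ (Fin.suc i) = e i
    eᵢ≉x : ∀ i → ¬ e i ≈ x
    eᵢ≉x i = S∌x (e i) (proj₂ (e-onto (e i)) (i , refl))
    e′-injective : ∀ i j → e′ i ≈ e′ j → i ≡ j
    e′-injective Fin.zero    Fin.zero    _       = ≡.refl
    e′-injective Fin.zero    (Fin.suc j) x≈eⱼ    = ⊥-elim (eᵢ≉x j (sym x≈eⱼ))
    e′-injective (Fin.suc i) Fin.zero    eᵢ≈x    = ⊥-elim (eᵢ≉x i eᵢ≈x)
    e′-injective (Fin.suc i) (Fin.suc j) eᵢ≈eⱼ   = ≡.cong Fin.suc (e-injective i j eᵢ≈eⱼ)
    onto : ∀ y → y ≈ x ⊎ S y → ∃ λ i → e′ i ≈ y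
    onto y (inj₁ y≈x) = Fin.zero , sym y≈x
    onto y (inj₂ Sy)  = let (i , eᵢ≈y) = proj₁ (e-onto y) Sy in Fin.suc i , eᵢ≈y
    into : ∀ y → (∃ λ i → e′ i ≈ y) → y ≈ x ⊎ S y
    into y (Fin.zero  , x≈y)  = inj₁ (sym x≈y)
    into y (Fin.suc i , eᵢ≈y) = inj₂ (proj₂ (e-onto y) (i , eᵢ≈y))

module Field (R : CommutativeRing 0ℓ 0ℓ) where
  open CommutativeRing R
  open FieldNotions R

  module Structure (_≟_ : Decidable _≈_) (1≉0 : ¬ 1# ≈ 0#) (inv : Carrier → Carrier)
                   (inv-r : ∀ x → ¬ x ≈ 0# → x * inv x ≈ 1#) where
    open Powers R
    open IntegerCoefficientRingSolver R
    open import Algebra.Properties.Group +-group using (x∙y⁻¹≈ε⇒x≈y; x≈y⇒x∙y⁻¹≈ε)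
    open import Algebra.Properties.Ring ring using (-0#≈0#; -‿involutive)
    open import Algebra.Properties.Semiring.Mult semiring using (_×_; ×-assocˡ; ×-congʳ)
    open import Relation.Binary.Reasoning.Setoid setoid

    x-y≈0⇒x≈y : ∀ {x y} → x - y ≈ 0# → x ≈ y
    x-y≈0⇒x≈y = x∙y⁻¹≈ε⇒x≈y _ _

    x≈y⇒x-y≈0 : ∀ {x y} → x ≈ y → x - y ≈ 0#
    x≈y⇒x-y≈0 = x≈y⇒x∙y⁻¹≈ε

    inv-l : ∀ x → ¬ x ≈ 0# → inv x * x ≈ 1#
    inv-l x x≉0 = trans (*-comm _ _) (inv-r x x≉0)

    *-cancelˡ : ∀ {x a b} → ¬ x ≈ 0# → x * a ≈ x * b → a ≈ b
    *-cancelˡ {x} {a} {b} x≉0 xa≈xb = begin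
      a               ≈⟨ sym (*-identityˡ a) ⟩
      1# * a          ≈⟨ *-congʳ (sym (inv-l x x≉0)) ⟩
      (inv x * x) * a ≈⟨ *-assoc _ _ _ ⟩
      inv x * (x * a) ≈⟨ *-congˡ xa≈xb ⟩
      inv x * (x * b) ≈⟨ sym (*-assoc _ _ _) ⟩
      (inv x * x) * b ≈⟨ *-congʳ (inv-l x x≉0) ⟩
      1# * b          ≈⟨ *-identityˡ b ⟩
      b               ∎

    zero-product : ∀ {x y} → x * y ≈ 0# → x ≈ 0# ⊎ y ≈ 0#
    zero-product {x} xy≈0 with x ≟ 0#
    ... | yes x≈0 = inj₁ x≈0
    ... | no  x≉0 = inj₂ (*-cancelˡ x≉0 (trans xy≈0 (sym (zeroʳ x))))

    *-nonzero : ∀ {x y} → ¬ x ≈ 0# → ¬ y ≈ 0# → ¬ x * y ≈ 0#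
    *-nonzero x≉0 y≉0 xy≈0 with zero-product xy≈0
    ... | inj₁ x≈0 = x≉0 x≈0
    ... | inj₂ y≈0 = y≉0 y≈0

    inv-cong : ∀ {x y} → ¬ x ≈ 0# → x ≈ y → inv x ≈ inv y
    inv-cong {x} {y} x≉0 x≈y = *-cancelˡ x≉0 (trans (inv-r x x≉0)
      (sym (trans (*-congʳ x≈y) (inv-r y (λ y≈0 → x≉0 (trans x≈y y≈0))))))

    *-inv≈⇒≈* : ∀ {a b c} → ¬ b ≈ 0# → a * inv b ≈ c → a ≈ c * b
    *-inv≈⇒≈* {a} {b} {c} b≉0 a/b≈c = begin
      a               ≈⟨ sym (*-identityʳ a) ⟩
      a * 1#          ≈⟨ *-congˡ (sym (inv-l b b≉0)) ⟩
      a * (inv b * b) ≈⟨ sym (*-assoc _ _ _) ⟩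
      a * inv b * b   ≈⟨ *-congʳ a/b≈c ⟩
      c * b           ∎

    ≈*⇒*-inv≈ : ∀ {a b c} → ¬ b ≈ 0# → a ≈ c * b → a * inv b ≈ c
    ≈*⇒*-inv≈ {a} {b} {c} b≉0 a≈cb = begin
      a * inv b       ≈⟨ *-congʳ a≈cb ⟩
      c * b * inv b   ≈⟨ *-assoc _ _ _ ⟩
      c * (b * inv b) ≈⟨ *-congˡ (inv-r b b≉0) ⟩
      c * 1#          ≈⟨ *-identityʳ c ⟩
      c               ∎

    *-inv-cross : ∀ {a b c e} → ¬ b ≈ 0# → ¬ e ≈ 0# → a * inv b ≈ c * inv e → a * e ≈ c * b
    *-inv-cross {a} {b} {c} {e} b≉0 e≉0 a/b≈c/e = begin
      a * e               ≈⟨ *-congʳ (*-inv≈⇒≈* b≉0 a/b≈c/e) ⟩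
      c * inv e * b * e   ≈⟨ solve 4 (λ c i b e → c :* i :* b :* e := c :* b :* (i :* e)) refl c (inv e) b e ⟩
      c * b * (inv e * e) ≈⟨ *-congˡ (inv-l e e≉0) ⟩
      c * b * 1#          ≈⟨ *-identityʳ _ ⟩
      c * b               ∎

    x*x≈1⇒x≈±1 : ∀ {x} → x * x ≈ 1# → x ≈ 1# ⊎ x ≈ - 1#
    x*x≈1⇒x≈±1 {x} x²≈1 = roots (zero-product [x-1][x+1]≈0)
      where
      [x-1][x+1]≈0 : (x - 1#) * (x + 1#) ≈ 0#
      [x-1][x+1]≈0 = trans
        (solve 1 (λ x → (x :- con (+ 1)) :* (x :+ con (+ 1)) := x :* x :- con (+ 1)) refl x)
        (x≈y⇒x-y≈0 x²≈1)
      roots : x - 1# ≈ 0# ⊎ x + 1# ≈ 0# → x ≈ 1# ⊎ x ≈ - 1#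
      roots (inj₁ x-1≈0) = inj₁ (x-y≈0⇒x≈y x-1≈0)
      roots (inj₂ x+1≈0) = inj₂ (x-y≈0⇒x≈y (trans (+-congˡ (-‿involutive 1#)) x+1≈0))

    x+x≉0 : ¬ 1# + 1# ≈ 0# → ∀ {x} → ¬ x ≈ 0# → ¬ x + x ≈ 0#
    x+x≉0 2≉0 {x} x≉0 x+x≈0 = *-nonzero 2≉0 x≉0
      (trans (solve 1 (λ x → (con (+ 1) :+ con (+ 1)) :* x := x :+ x) refl x) x+x≈0)

    pow-nonzero : ∀ {x} n → ¬ x ≈ 0# → ¬ pow x n ≈ 0#
    pow-nonzero zero    x≉0 = 1≉0
    pow-nonzero (suc n) x≉0 = *-nonzero x≉0 (pow-nonzero n x≉0)

    IsPower-cong : ∀ {m x y} → x ≈ y → IsPower m x → IsPower m y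
    IsPower-cong x≈y (u , u≉0 , uᵐ≈x) = u , u≉0 , trans uᵐ≈x x≈y

    IsPower-* : ∀ {m x y} → IsPower m x → IsPower m y → IsPower m (x * y)
    IsPower-* {m} (u , u≉0 , uᵐ≈x) (v , v≉0 , vᵐ≈y) =
      u * v , *-nonzero u≉0 v≉0 , trans (pow-distrib-* u v m) (*-cong uᵐ≈x vᵐ≈y)

    IsPower-pow : ∀ {m x} n → IsPower m x → IsPower m (pow x n)
    IsPower-pow {m} {x} n (u , u≉0 , uᵐ≈x) = pow u n , pow-nonzero n u≉0 , (begin
      pow (pow u n) m ≈⟨ pow-assocʳ u n m ⟩
      pow u (n ℕ.* m) ≡⟨ ≡.cong (pow u) (ℕ.*-comm n m) ⟩
      pow u (m ℕ.* n) ≈⟨ sym (pow-assocʳ u m n) ⟩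
      pow (pow u m) n ≈⟨ pow-congˡ n uᵐ≈x ⟩
      pow x n         ∎)

    pow≈0⇒≈0 : ∀ {x} n → pow x n ≈ 0# → x ≈ 0#
    pow≈0⇒≈0 zero    1≈0 = ⊥-elim (1≉0 1≈0)
    pow≈0⇒≈0 (suc n) xxⁿ≈0 with zero-product xxⁿ≈0
    ... | inj₁ x≈0  = x≈0
    ... | inj₂ xⁿ≈0 = pow≈0⇒≈0 n xⁿ≈0

    odd×1≈0⇒2≉0 : ∀ {n} → Odd n → n × 1# ≈ 0# → ¬ 1# + 1# ≈ 0#
    odd×1≈0⇒2≉0 (t , ≡.refl) [1+2t]×1≈0 2≈0 = 1≉0 (begin
      1#                     ≈⟨ sym (+-identityʳ 1#) ⟩
      1# + 0#                ≈⟨ +-congˡ (sym (t×0≈0 t)) ⟩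
      1# + t × 0#            ≈⟨ +-congˡ (×-congʳ t (sym (trans (+-congˡ (+-identityʳ 1#)) 2≈0))) ⟩
      1# + t × (2 × 1#)      ≈⟨ +-congˡ (×-assocˡ 1# t 2) ⟩
      suc (t ℕ.* 2) × 1#     ≈⟨ [1+2t]×1≈0 ⟩
      0#                     ∎)
      where
      t×0≈0 : ∀ n → n × 0# ≈ 0#
      t×0≈0 zero    = refl
      t×0≈0 (suc n) = trans (+-identityˡ _) (t×0≈0 n)

    module Möbius (α d : Carrier) (α²≈d : α * α ≈ d) (d≉0 : ¬ d ≈ 0#) (2≉0 : ¬ 1# + 1# ≈ 0#) where
      open Psi _≟_ inv α d

      α≉0 : ¬ α ≈ 0#
      α≉0 α≈0 = d≉0 (trans (sym α²≈d) (trans (*-congʳ α≈0) (zeroˡ α)))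

      2α≉0 : ¬ α + α ≈ 0#
      2α≉0 = x+x≉0 2≉0 α≉0

      private
        z-α≉0 : ∀ {z} → ¬ z ≈ α → ¬ z - α ≈ 0#
        z-α≉0 z≉α z-α≈0 = z≉α (x-y≈0⇒x≈y z-α≈0)

      ψ-≈α : ∀ {z} → z ≈ α → ψ z ≈ α
      ψ-≈α {z} z≈α with z ≟ α
      ... | yes _   = refl
      ... | no  z≉α = ⊥-elim (z≉α z≈α)

      ψ-≉α : ∀ {z} → ¬ z ≈ α → ψ z ≈ (α * z + d) * inv (z - α)
      ψ-≉α {z} z≉α with z ≟ α
      ... | yes z≈α = ⊥-elim (z≉α z≈α)
      ... | no  _   = refl

      ψ-cong : ∀ {u v} → u ≈ v → ψ u ≈ ψ v
      ψ-cong {u} {v} u≈v = by-cases (u ≟ α)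
        where
        by-cases : Dec (u ≈ α) → ψ u ≈ ψ v
        by-cases (yes u≈α) = trans (ψ-≈α u≈α) (sym (ψ-≈α (trans (sym u≈v) u≈α)))
        by-cases (no  u≉α) = trans (ψ-≉α u≉α) (trans
          (*-cong (+-congʳ (*-congˡ u≈v)) (inv-cong (z-α≉0 u≉α) (+-congʳ u≈v)))
          (sym (ψ-≉α (λ v≈α → u≉α (trans u≈v v≈α)))))

      ψ≉α : ∀ {z} → ¬ z ≈ α → ¬ ψ z ≈ α
      ψ≉α {z} z≉α ψz≈α = x+x≉0 2≉0 d≉0 (begin
        d + d                       ≈⟨ +-congˡ (sym α²≈d) ⟩
        d + α * α                   ≈⟨ solve 3 (λ a z d → d :+ a :* a := (a :* z :+ d) :- a :* (z :- a)) refl α z d ⟩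
        (α * z + d) - α * (z - α)   ≈⟨ x≈y⇒x-y≈0 (*-inv≈⇒≈* (z-α≉0 z≉α) (trans (sym (ψ-≉α z≉α)) ψz≈α)) ⟩
        0#                          ∎)

      ψ-injective : ∀ {u v} → ψ u ≈ ψ v → u ≈ v
      ψ-injective {u} {v} ψu≈ψv = by-cases (u ≟ α) (v ≟ α)
        where
        by-cases : Dec (u ≈ α) → Dec (v ≈ α) → u ≈ v
        by-cases (yes u≈α) (yes v≈α) = trans u≈α (sym v≈α)
        by-cases (yes u≈α) (no  v≉α) = ⊥-elim (ψ≉α v≉α (trans (sym ψu≈ψv) (ψ-≈α u≈α)))
        by-cases (no  u≉α) (yes v≈α) = ⊥-elim (ψ≉α u≉α (trans ψu≈ψv (ψ-≈α v≈α)))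
        by-cases (no  u≉α) (no  v≉α) with zero-product (begin
          (d + d) * (v - u)                             ≈⟨ *-congʳ (+-congˡ (sym α²≈d)) ⟩
          (d + α * α) * (v - u)                         ≈⟨ solve 4 (λ a u v d → (d :+ a :* a) :* (v :- u)
                                                             := (a :* u :+ d) :* (v :- a) :- (a :* v :+ d) :* (u :- a)) refl α u v d ⟩
          (α * u + d) * (v - α) - (α * v + d) * (u - α) ≈⟨ x≈y⇒x-y≈0 (*-inv-cross (z-α≉0 u≉α) (z-α≉0 v≉α)
                                                             (trans (sym (ψ-≉α u≉α)) (trans ψu≈ψv (ψ-≉α v≉α)))) ⟩
          0#                                            ∎)
        ... | inj₁ d+d≈0 = ⊥-elim (x+x≉0 2≉0 d≉0 d+d≈0)
        ... | inj₂ v-u≈0 = sym (x-y≈0⇒x≈y v-u≈0)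

      ψ-0 : ψ 0# ≈ - α
      ψ-0 = trans (ψ-≉α (λ 0≈α → α≉0 (sym 0≈α))) (≈*⇒*-inv≈ 0-α≉0 (x-y≈0⇒x≈y (begin
        (α * 0# + d) - (- α) * (0# - α) ≈⟨ solve 2 (λ a d → (a :* con (+ 0) :+ d) :- (:- a) :* (con (+ 0) :- a)
                                               := d :- a :* a) refl α d ⟩
        d - α * α                       ≈⟨ x≈y⇒x-y≈0 (sym α²≈d) ⟩
        0#                              ∎)))
        where
        0-α≉0 : ¬ 0# - α ≈ 0#
        0-α≉0 0-α≈0 = α≉0 (sym (x-y≈0⇒x≈y 0-α≈0))

      ψ[αγ]≈x⇔[x-α]γ≈x+α : ∀ {γ x} → ¬ γ ≈ 1# → ψ (α * γ) ≈ x ⇔ (x - α) * γ ≈ x + α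
      ψ[αγ]≈x⇔[x-α]γ≈x+α {γ} {x} γ≉1 = mk⇔
        (λ ψ[αγ]≈x → x-y≈0⇒x≈y (-α*E≈0⇒E≈0 (trans (sym key) (x≈y⇒x-y≈0
          (*-inv≈⇒≈* αγ-α≉0 (trans (sym (ψ-≉α αγ≉α)) ψ[αγ]≈x))))))
        (λ [x-α]γ≈x+α → trans (ψ-≉α αγ≉α) (≈*⇒*-inv≈ αγ-α≉0 (x-y≈0⇒x≈y
          (trans key (trans (*-congˡ (x≈y⇒x-y≈0 [x-α]γ≈x+α)) (zeroʳ _))))))
        where
        αγ≉α : ¬ α * γ ≈ α
        αγ≉α αγ≈α = γ≉1 (*-cancelˡ α≉0 (trans αγ≈α (sym (*-identityʳ α))))
        αγ-α≉0 : ¬ α * γ - α ≈ 0#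
        αγ-α≉0 = z-α≉0 αγ≉α
        E : Carrier
        E = (x - α) * γ - (x + α)
        key : (α * (α * γ) + d) - x * (α * γ - α) ≈ (- α) * E
        key = begin
          (α * (α * γ) + d) - x * (α * γ - α) ≈⟨ solve 4 (λ a g x d → (a :* (a :* g) :+ d) :- x :* (a :* g :- a)
                                                   := (:- a) :* ((x :- a) :* g :- (x :+ a)) :+ (d :- a :* a)) refl α γ x d ⟩
          (- α) * E + (d - α * α)             ≈⟨ +-congˡ (x≈y⇒x-y≈0 (sym α²≈d)) ⟩
          (- α) * E + 0#                      ≈⟨ +-identityʳ _ ⟩
          (- α) * E                           ∎
        -α*E≈0⇒E≈0 : (- α) * E ≈ 0# → E ≈ 0#
        -α*E≈0⇒E≈0 -αE≈0 with zero-product -αE≈0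
        ... | inj₁ -α≈0 = ⊥-elim (α≉0 (trans (sym (-‿involutive α)) (trans (-‿cong -α≈0) -0#≈0#)))
        ... | inj₂ E≈0  = E≈0

module FiniteField (R : CommutativeRing 0ℓ 0ℓ) {N : ℕ} (F : IsFiniteFieldOfSize R N) where
  open CommutativeRing R
  open IsFiniteFieldOfSize F
  open FieldNotions R
  open Powers R
  open IntegerCoefficientRingSolver R
  open Field.Structure R _≟_ 1≉0 inv inv-r
  open Frobenius R using (frobenius-^)
  open import Algebra.Properties.Semiring.Mult semiring using (_×_; ×1-homo-*; ×-congˡ)
  open import Algebra.Properties.CommutativeMonoid.Sum +-commutativeMonoid
    using (sum; sum-permute; sum-cong-≋; ∑-distrib-+; sum-replicate)
  open import Relation.Binary.Reasoning.Setoid setoid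

  index : Carrier → Fin N
  index x = proj₁ (enum-surj x)

  enum-index : ∀ x → enum (index x) ≈ x
  enum-index x = proj₂ (enum-surj x)

  injective⇒≤ : ∀ {k} (f : Fin k → Carrier) → (∀ i j → f i ≈ f j → i ≡ j) → k ≤ N
  injective⇒≤ f f-injective = Fin.injective⇒≤ λ {i} {j} index-fi≡index-fj →
    f-injective i j (trans (sym (enum-index (f i)))
      (trans (reflexive (≡.cong enum index-fi≡index-fj)) (enum-index (f j))))

  -- Translation by 1# permutes the field, so it fixes the sum of all elements.
  N×1≈0 : N × 1# ≈ 0#
  N×1≈0 = begin
    N × 1#                ≈⟨ solve 2 (λ t s → t := (s :+ t) :- s) refl (N × 1#) S ⟩
    (S + N × 1#) - S      ≈⟨ +-congʳ (sym S≈S+N×1) ⟩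
    S - S                 ≈⟨ -‿inverseʳ S ⟩
    0#                    ∎
    where
    shift unshift : Fin N → Fin N
    shift i   = index (enum i + 1#)
    unshift i = index (enum i - 1#)
    shift-unshift : ∀ i → shift (unshift i) ≡ i
    shift-unshift i = enum-inj _ _ (trans (enum-index _) (trans (+-congʳ (enum-index _))
      (solve 1 (λ x → x :- con (+ 1) :+ con (+ 1) := x) refl (enum i))))
    unshift-shift : ∀ i → unshift (shift i) ≡ i
    unshift-shift i = enum-inj _ _ (trans (enum-index _) (trans (+-congʳ (enum-index _))
      (solve 1 (λ x → x :+ con (+ 1) :- con (+ 1) := x) refl (enum i))))
    S : Carrier
    S = sum enum
    S≈S+N×1 : S ≈ S + N × 1#
    S≈S+N×1 = begin
      S                              ≈⟨ sum-permute enum (permutation shift unshift shift-unshift unshift-shift) ⟩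
      sum {N} (λ i → enum (shift i)) ≈⟨ sum-cong-≋ {N} (λ i → enum-index (enum i + 1#)) ⟩
      sum {N} (λ i → enum i + 1#)    ≈⟨ ∑-distrib-+ enum (λ _ → 1#) ⟩
      S + sum {N} (λ _ → 1#)         ≈⟨ +-congˡ (sum-replicate N) ⟩
      S + N × 1#                     ∎

  size≡pᵉ⇒p×1≈0 : ∀ p e → N ≡ p ℕ.^ e → p × 1# ≈ 0#
  size≡pᵉ⇒p×1≈0 p e N≡pᵉ = pow≈0⇒≈0 e (trans (sym (^×1≈pow e)) (trans (×-congˡ (≡.sym N≡pᵉ)) N×1≈0))
    where
    ^×1≈pow : ∀ e → (p ℕ.^ e) × 1# ≈ pow (p × 1#) e
    ^×1≈pow zero    = +-identityʳ 1#
    ^×1≈pow (suc e) = trans (×1-homo-* p (p ℕ.^ e)) (*-congˡ (^×1≈pow e))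

  size≡pᵉ⇒frobenius : ∀ {p e} → Prime p → N ≡ p ℕ.^ e →
                      ∀ f x y → pow (x + y) (p ℕ.^ f) ≈ pow x (p ℕ.^ f) + pow y (p ℕ.^ f)
  size≡pᵉ⇒frobenius {p} {e} p-prime N≡pᵉ = frobenius-^ p-prime (size≡pᵉ⇒p×1≈0 p e N≡pᵉ)

  size≡pᵉ∧odd⇒2≉0 : ∀ {p e} → Odd p → N ≡ p ℕ.^ e → ¬ 1# + 1# ≈ 0#
  size≡pᵉ∧odd⇒2≉0 {p} {e} p-odd N≡pᵉ = odd×1≈0⇒2≉0 p-odd (size≡pᵉ⇒p×1≈0 p e N≡pᵉ)

  module PrimitiveElement (β : Carrier) (β-primitive : IsPrimitive N β) {{L≢0 : NonZero (N ℕ.∸ 1)}} where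

    private
      L : ℕ
      L = N ℕ.∸ 1

      βᴸ≈1 : pow β L ≈ 1#
      βᴸ≈1 = proj₁ β-primitive

    β≉0 : ¬ β ≈ 0#
    β≉0 β≈0 = 1≉0 (trans (sym βᴸ≈1) (trans (pow-congˡ L β≈0) (0ᴸ≈0 L)))
      where
      0ᴸ≈0 : ∀ n → {{NonZero n}} → pow 0# n ≈ 0#
      0ᴸ≈0 (suc n) = zeroˡ _

    pow-β≈1⇒∣ : ∀ a → pow β a ≈ 1# → L ∣ a
    pow-β≈1⇒∣ a βᵃ≈1 with a % L in a%L≡r
    ... | zero  = m%n≡0⇒n∣m a L a%L≡r
    ... | suc r = ⊥-elim (proj₂ β-primitive (suc r) (s≤s z≤n) (≡.subst (_< L) a%L≡r (m%n<n a L)) βʳ≈1)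
      where
      βʳ≈1 : pow β (suc r) ≈ 1#
      βʳ≈1 = begin
        pow β (suc r)                          ≈⟨ sym (*-identityʳ _) ⟩
        pow β (suc r) * 1#                     ≈⟨ *-congˡ (sym (pow≈1⇒pow-*≈1 L (a / L) βᴸ≈1)) ⟩
        pow β (suc r) * pow β (L ℕ.* (a / L))  ≈⟨ sym (pow-homo-* β (suc r) _) ⟩
        pow β (suc r ℕ.+ L ℕ.* (a / L))        ≡⟨ ≡.cong (pow β) (≡.sym (≡.trans (m≡m%n+[m/n]*n a L)
                                                    (≡.cong₂ ℕ._+_ a%L≡r (ℕ.*-comm (a / L) L)))) ⟩
        pow β a                                ≈⟨ βᵃ≈1 ⟩
        1#                                     ∎

    ∣⇒pow-β≈1 : ∀ a → L ∣ a → pow β a ≈ 1#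
    ∣⇒pow-β≈1 a (divides t ≡.refl) =
      trans (reflexive (≡.cong (pow β) (ℕ.*-comm t L))) (pow≈1⇒pow-*≈1 L t βᴸ≈1)

    private
      pow-β-shift : ∀ i t → i ℕ.+ t < L → pow β i ≈ pow β (i ℕ.+ t) → t ≡ 0
      pow-β-shift i zero    _       _       = ≡.refl
      pow-β-shift i (suc t) i+t<L βⁱ≈βⁱ⁺ᵗ = ⊥-elim (ℕ.<-irrefl ≡.refl
        (ℕ.<-≤-trans i+t<L (ℕ.≤-trans (∣⇒≤ (pow-β≈1⇒∣ (suc t) βᵗ≈1)) (ℕ.m≤n+m (suc t) i))))
        where
        βᵗ≈1 : pow β (suc t) ≈ 1#
        βᵗ≈1 = *-cancelˡ (pow-nonzero i β≉0)
          (trans (sym (pow-homo-* β i (suc t))) (trans (sym βⁱ≈βⁱ⁺ᵗ) (sym (*-identityʳ _))))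

    pow-β-injective : ∀ {i j} → i < L → j < L → pow β i ≈ pow β j → i ≡ j
    pow-β-injective {i} {j} i<L j<L βⁱ≈βʲ with ℕ.≤-total i j
    ... | inj₁ i≤j with ℕ.m≤n⇒∃[o]m+o≡n i≤j
    ...   | t , ≡.refl = ≡.sym (≡.trans (≡.cong (i ℕ.+_) (pow-β-shift i t j<L βⁱ≈βʲ)) (ℕ.+-identityʳ i))
    pow-β-injective {i} {j} i<L j<L βⁱ≈βʲ | inj₂ j≤i with ℕ.m≤n⇒∃[o]m+o≡n j≤i
    ...   | t , ≡.refl = ≡.trans (≡.cong (j ℕ.+_) (pow-β-shift j t i<L (sym βⁱ≈βʲ))) (ℕ.+-identityʳ j)

    -- 0#, x and the L distinct powers of β would be L + 2 ≥ N + 1 distinct elements.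
    discrete-log : ∀ x → ¬ x ≈ 0# → ∃ λ e → x ≈ pow β e
    discrete-log x x≉0 with Fin.any? {n = L} (λ i → x ≟ pow β (toℕ i))
    ... | yes (i , x≈βⁱ) = toℕ i , x≈βⁱ
    ... | no  x≉βⁱ      = ⊥-elim (ℕ.<-irrefl ≡.refl
            (ℕ.<-≤-trans (injective⇒≤ f f-injective) (ℕ.m≤n+m∸n N 1)))
      where
      f : Fin (2 ℕ.+ L) → Carrier
      f Fin.zero                 = 0#
      f (Fin.suc Fin.zero)       = x
      f (Fin.suc (Fin.suc i))    = pow β (toℕ i)
      βⁱ≉0 : ∀ (i : Fin L) → ¬ pow β (toℕ i) ≈ 0#
      βⁱ≉0 i = pow-nonzero (toℕ i) β≉0
      f-injective : ∀ i j → f i ≈ f j → i ≡ j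
      f-injective Fin.zero              Fin.zero              _ = ≡.refl
      f-injective Fin.zero              (Fin.suc Fin.zero)    e = ⊥-elim (x≉0 (sym e))
      f-injective Fin.zero              (Fin.suc (Fin.suc j)) e = ⊥-elim (βⁱ≉0 j (sym e))
      f-injective (Fin.suc Fin.zero)    Fin.zero              e = ⊥-elim (x≉0 e)
      f-injective (Fin.suc Fin.zero)    (Fin.suc Fin.zero)    _ = ≡.refl
      f-injective (Fin.suc Fin.zero)    (Fin.suc (Fin.suc j)) e = ⊥-elim (x≉βⁱ (j , e))
      f-injective (Fin.suc (Fin.suc i)) Fin.zero              e = ⊥-elim (βⁱ≉0 i e)
      f-injective (Fin.suc (Fin.suc i)) (Fin.suc Fin.zero)    e = ⊥-elim (x≉βⁱ (i , sym e))
      f-injective (Fin.suc (Fin.suc i)) (Fin.suc (Fin.suc j)) e = ≡.cong (Fin.suc ∘ Fin.suc)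
        (Fin.toℕ-injective (pow-β-injective (Fin.toℕ<n i) (Fin.toℕ<n j) e))

    pow≈1⇒IsPower : ∀ {z c m} → L ≡ c ℕ.* m → ¬ z ≈ 0# → pow z c ≈ 1# → IsPower m z
    pow≈1⇒IsPower {z} {c} {m} L≡cm z≉0 zᶜ≈1 = pow β u , pow-nonzero u β≉0 , (begin
      pow (pow β u) m  ≈⟨ pow-assocʳ β u m ⟩
      pow β (u ℕ.* m)  ≡⟨ ≡.cong (pow β) (≡.sym t≡um) ⟩
      pow β t          ≈⟨ sym z≈βᵗ ⟩
      z                ∎)
      where
      t : ℕ
      t = proj₁ (discrete-log z z≉0)
      z≈βᵗ : z ≈ pow β t
      z≈βᵗ = proj₂ (discrete-log z z≉0)
      instance
        c≢0 : NonZero c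
        c≢0 = ℕ.≢-nonZero λ { ≡.refl → ℕ.≢-nonZero⁻¹ L L≡cm }
      m∣t : m ∣ t
      m∣t = *-cancelˡ-∣ c (≡.subst₂ _∣_ L≡cm (ℕ.*-comm t c) (pow-β≈1⇒∣ (t ℕ.* c)
        (trans (sym (pow-assocʳ β t c)) (trans (pow-congˡ c (sym z≈βᵗ)) zᶜ≈1))))
      u : ℕ
      u = _∣_.quotient m∣t
      t≡um : t ≡ u ℕ.* m
      t≡um = _∣_.equality m∣t

open import Data.Product using (_×_)

odd-prime-power : ∀ {p e q} → Prime p → p ≢ 2 → q ≡ p ℕ.^ suc e → ∃ λ h → q ≡ suc (h ℕ.* 2) × NonZero h
odd-prime-power {p} {e} p-prime p≢2 q≡pᵉ
  with ≡.subst Odd (≡.sym q≡pᵉ) (odd-^ (prime≢2⇒odd p-prime p≢2) (suc e))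
... | suc h , q≡1+2h = suc h , q≡1+2h , _
... | zero  , q≡1    =
  ⊥-elim (¬prime[1] (≡.subst Prime (ℕ.m*n≡1⇒m≡1 p (p ℕ.^ e) (≡.trans (≡.sym q≡pᵉ) q≡1)) p-prime))

[q*q-1]≡[q-1][q+1] : ∀ {q} h → q ≡ suc (h ℕ.* 2) → q ℕ.* q ℕ.∸ 1 ≡ h ℕ.* 2 ℕ.* (q ℕ.+ 1)
[q*q-1]≡[q-1][q+1] h ≡.refl = expand (h ℕ.* 2)
  where
  expand : ∀ a → a ℕ.+ a ℕ.* suc a ≡ a ℕ.* (suc a ℕ.+ 1)
  expand = solve-∀

quotient-even : ∀ {q m k} h .{{_ : NonZero m}} → q ≡ suc (h ℕ.* 2) → q ℕ.+ 1 ≡ k ℕ.* m →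
                m ∣ (q ℕ.+ 1) / 2 → ∃ λ j → k ≡ j ℕ.* 2
quotient-even {q} {m} {k} h q≡1+2h q+1≡km (divides j [q+1]/2≡jm) = j , ℕ.*-cancelʳ-≡ k (j ℕ.* 2) m (begin
  k ℕ.* m         ≡⟨ ≡.sym q+1≡km ⟩
  q ℕ.+ 1         ≡⟨ q+1≡[1+h]*2 ⟩
  suc h ℕ.* 2     ≡⟨ ≡.cong (ℕ._* 2) 1+h≡jm ⟩
  j ℕ.* m ℕ.* 2   ≡⟨ swap j m ⟩
  j ℕ.* 2 ℕ.* m   ∎)
  where
  open ≡.≡-Reasoning
  swap : ∀ j m → j ℕ.* m ℕ.* 2 ≡ j ℕ.* 2 ℕ.* m
  swap = solve-∀
  q+1≡[1+h]*2 : q ℕ.+ 1 ≡ suc h ℕ.* 2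
  q+1≡[1+h]*2 = ≡.trans (≡.cong (ℕ._+ 1) q≡1+2h) (≡.cong suc (ℕ.+-comm (h ℕ.* 2) 1))
  1+h≡jm : suc h ≡ j ℕ.* m
  1+h≡jm = ≡.trans (≡.sym (≡.trans (≡.cong (_/ 2) q+1≡[1+h]*2) (m*n/n≡m (suc h) 2))) [q+1]/2≡jm

module PaleyClique (R : CommutativeRing 0ℓ 0ℓ) where
  open CommutativeRing R
  open FieldNotions R

  module Construction
    (q m k h : ℕ) (q≡1+2h : q ≡ suc (h ℕ.* 2)) {{h≢0 : NonZero h}} (q+1≡km : q ℕ.+ 1 ≡ k ℕ.* m)
    (F : IsFiniteFieldOfSize R (q ℕ.* q))
    (frobenius-q : ∀ x y → pow (x + y) q ≈ pow x q + pow y q) (2≉0 : ¬ 1# + 1# ≈ 0#)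
    (d α β : Carrier) (d∈Fq : InFq q d) (d≉0 : ¬ d ≈ 0#) (d-nonsquare : ¬ ∃ λ y → InFq q y × y * y ≈ d)
    (α²≈d : α * α ≈ d) (β-primitive : IsPrimitive (q ℕ.* q) β) where

    open IsFiniteFieldOfSize F
    open Powers R
    open Field.Structure R _≟_ 1≉0 inv inv-r
    open Möbius α d α²≈d d≉0 2≉0
    open Psi _≟_ inv α d
    open Cardinality R
    open IntegerCoefficientRingSolver R using (solve; _:=_; _:+_; _:-_; _:*_; :-_; con)
    open import Algebra.Properties.Ring ring using (-0#≈0#; -‿involutive; -1*x≈-x)
    open import Relation.Binary.Reasoning.Setoid setoid

    L : ℕ
    L = q ℕ.* q ℕ.∸ 1

    L≡[q-1][q+1] : L ≡ h ℕ.* 2 ℕ.* (q ℕ.+ 1)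
    L≡[q-1][q+1] = [q*q-1]≡[q-1][q+1] h q≡1+2h

    q-1≡2h : q ℕ.∸ 1 ≡ h ℕ.* 2
    q-1≡2h = ≡.cong (ℕ._∸ 1) q≡1+2h

    L≡[q-1]km : L ≡ h ℕ.* 2 ℕ.* k ℕ.* m
    L≡[q-1]km = ≡.trans L≡[q-1][q+1] (≡.trans (≡.cong (h ℕ.* 2 ℕ.*_) q+1≡km) (≡.sym (ℕ.*-assoc (h ℕ.* 2) k m)))

    instance
      L≢0 : NonZero L
      L≢0 = ≡.subst NonZero (≡.sym L≡[q-1][q+1])
        (ℕ.m*n≢0 (h ℕ.* 2) (q ℕ.+ 1) {{ℕ.m*n≢0 h 2}} {{≡.subst NonZero (ℕ.+-comm 1 q) _}})

    open FiniteField R F using (module PrimitiveElement)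
    open PrimitiveElement β β-primitive

    pow-q : ∀ x → pow x q ≈ x * pow x (h ℕ.* 2)
    pow-q x = ≡.subst (λ n → pow x n ≈ x * pow x (h ℕ.* 2)) (≡.sym q≡1+2h) refl

    frobenius-neg : ∀ x → pow (- x) q ≈ - pow x q
    frobenius-neg x = begin
      pow (- x) q                            ≈⟨ solve 2 (λ y z → y := (z :+ y) :- z) refl (pow (- x) q) (pow x q) ⟩
      (pow x q + pow (- x) q) - pow x q      ≈⟨ +-congʳ (sym (frobenius-q x (- x))) ⟩
      pow (x - x) q - pow x q                ≈⟨ +-congʳ (trans (pow-congˡ q (-‿inverseʳ x)) (trans (pow-q 0#) (zeroˡ _))) ⟩
      0# - pow x q                           ≈⟨ +-identityˡ _ ⟩
      - pow x q                              ∎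

    frobenius-sub : ∀ x y → pow (x - y) q ≈ pow x q - pow y q
    frobenius-sub x y = trans (frobenius-q x (- y)) (+-congˡ (frobenius-neg y))

    InFq-cong : ∀ {x y} → x ≈ y → InFq q x → InFq q y
    InFq-cong x≈y xᵠ≈x = trans (pow-congˡ q (sym x≈y)) (trans xᵠ≈x x≈y)

    InFq-0 : InFq q 0#
    InFq-0 = trans (pow-q 0#) (zeroˡ _)

    InFq-1 : InFq q 1#
    InFq-1 = pow-1# q

    InFq-+ : ∀ {x y} → InFq q x → InFq q y → InFq q (x + y)
    InFq-+ xᵠ≈x yᵠ≈y = trans (frobenius-q _ _) (+-cong xᵠ≈x yᵠ≈y)

    InFq-neg : ∀ {x} → InFq q x → InFq q (- x)
    InFq-neg xᵠ≈x = trans (frobenius-neg _) (-‿cong xᵠ≈x)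

    InFq-- : ∀ {x y} → InFq q x → InFq q y → InFq q (x - y)
    InFq-- xᵠ≈x yᵠ≈y = InFq-+ xᵠ≈x (InFq-neg yᵠ≈y)

    InFq⇒pow[q-1]≈1 : ∀ {x} → InFq q x → ¬ x ≈ 0# → pow x (h ℕ.* 2) ≈ 1#
    InFq⇒pow[q-1]≈1 {x} xᵠ≈x x≉0 = *-cancelˡ x≉0 (trans (sym (pow-q x)) (trans xᵠ≈x (sym (*-identityʳ x))))

    pow[q-1]≈square : ∀ x → pow x (h ℕ.* 2) ≈ pow x h * pow x h
    pow[q-1]≈square x = trans (sym (pow-assocʳ x h 2)) (*-congˡ (*-identityʳ (pow x h)))

    pow[q-1]/2≈1⇒square : ∀ {x} → ¬ x ≈ 0# → pow x h ≈ 1# → ∃ λ y → InFq q y × y * y ≈ x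
    pow[q-1]/2≈1⇒square {x} x≉0 xʰ≈1 = y , y∈Fq , y*y≈x
      where
      double : ∀ u n → u ℕ.* n ℕ.+ u ℕ.* n ≡ u ℕ.* (2 ℕ.* n)
      double = solve-∀
      rearrange : ∀ u n c → u ℕ.* n ℕ.* c ≡ u ℕ.* (c ℕ.* n)
      rearrange = solve-∀
      t : ℕ
      t = proj₁ (discrete-log x x≉0)
      x≈βᵗ : x ≈ pow β t
      x≈βᵗ = proj₂ (discrete-log x x≉0)
      2[q+1]∣t : 2 ℕ.* (q ℕ.+ 1) ∣ t
      2[q+1]∣t = *-cancelˡ-∣ h (≡.subst₂ _∣_ (≡.trans L≡[q-1][q+1] (ℕ.*-assoc h 2 (q ℕ.+ 1))) (ℕ.*-comm t h)
        (pow-β≈1⇒∣ (t ℕ.* h) (trans (sym (pow-assocʳ β t h)) (trans (pow-congˡ h (sym x≈βᵗ)) xʰ≈1))))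
      u : ℕ
      u = _∣_.quotient 2[q+1]∣t
      y : Carrier
      y = pow β (u ℕ.* (q ℕ.+ 1))
      y*y≈x : y * y ≈ x
      y*y≈x = begin
        y * y                                        ≈⟨ sym (pow-homo-* β (u ℕ.* (q ℕ.+ 1)) (u ℕ.* (q ℕ.+ 1))) ⟩
        pow β (u ℕ.* (q ℕ.+ 1) ℕ.+ u ℕ.* (q ℕ.+ 1))  ≡⟨ ≡.cong (pow β) (double u (q ℕ.+ 1)) ⟩
        pow β (u ℕ.* (2 ℕ.* (q ℕ.+ 1)))              ≡⟨ ≡.cong (pow β) (≡.sym (_∣_.equality 2[q+1]∣t)) ⟩
        pow β t                                      ≈⟨ sym x≈βᵗ ⟩
        x                                            ∎
      y∈Fq : InFq q y
      y∈Fq = begin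
        pow y q                                      ≈⟨ pow-q y ⟩
        y * pow y (h ℕ.* 2)                          ≈⟨ *-congˡ (pow-assocʳ β (u ℕ.* (q ℕ.+ 1)) (h ℕ.* 2)) ⟩
        y * pow β (u ℕ.* (q ℕ.+ 1) ℕ.* (h ℕ.* 2))    ≈⟨ *-congˡ (∣⇒pow-β≈1 _ (divides u (≡.trans
                                                         (rearrange u (q ℕ.+ 1) (h ℕ.* 2))
                                                         (≡.cong (u ℕ.*_) (≡.sym L≡[q-1][q+1]))))) ⟩
        y * 1#                                       ≈⟨ *-identityʳ y ⟩
        y                                            ∎

    d^h≈-1 : pow d h ≈ - 1#
    d^h≈-1 with x*x≈1⇒x≈±1 (trans (sym (pow[q-1]≈square d)) (InFq⇒pow[q-1]≈1 d∈Fq d≉0))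
    ... | inj₁ dʰ≈1  = ⊥-elim (d-nonsquare (pow[q-1]/2≈1⇒square d≉0 dʰ≈1))
    ... | inj₂ dʰ≈-1 = dʰ≈-1

    α^q≈-α : pow α q ≈ - α
    α^q≈-α = begin
      pow α q                 ≈⟨ pow-q α ⟩
      α * pow α (h ℕ.* 2)     ≈⟨ *-congˡ (pow[q-1]≈square α) ⟩
      α * (pow α h * pow α h) ≈⟨ *-congˡ (sym (pow-distrib-* α α h)) ⟩
      α * pow (α * α) h       ≈⟨ *-congˡ (trans (pow-congˡ h α²≈d) d^h≈-1) ⟩
      α * - 1#                ≈⟨ solve 1 (λ a → a :* (:- con (+ 1)) := :- a) refl α ⟩
      - α                     ∎

    α∉Fq : ¬ InFq q α
    α∉Fq α^q≈α = 2α≉0 (trans (+-congʳ (trans (sym α^q≈α) α^q≈-α)) (-‿inverseˡ α))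

    InFq⇒≉α : ∀ {x} → InFq q x → ¬ x ≈ α
    InFq⇒≉α x∈Fq x≈α = α∉Fq (InFq-cong x≈α x∈Fq)

    InFq⇒x-α≉0 : ∀ {x} → InFq q x → ¬ x - α ≈ 0#
    InFq⇒x-α≉0 x∈Fq x-α≈0 = InFq⇒≉α x∈Fq (x-y≈0⇒x≈y x-α≈0)

    pow-[x-α]-q : ∀ x → pow (x - α) q ≈ pow x q + α
    pow-[x-α]-q x = trans (frobenius-sub x α) (+-congˡ (trans (-‿cong α^q≈-α) (-‿involutive α)))

    pow-[x+α]-q : ∀ x → pow (x + α) q ≈ pow x q - α
    pow-[x+α]-q x = trans (frobenius-q x α) (+-congˡ α^q≈-α)

    InFq⇒pow-[x-α]-q : ∀ {x} → InFq q x → pow (x - α) q ≈ x + α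
    InFq⇒pow-[x-α]-q {x} xᵠ≈x = trans (pow-[x-α]-q x) (+-congʳ xᵠ≈x)

    pow[q-1]k≈1⇒IsPower : ∀ {z} → ¬ z ≈ 0# → pow z (h ℕ.* 2 ℕ.* k) ≈ 1# → IsPower m z
    pow[q-1]k≈1⇒IsPower = pow≈1⇒IsPower {c = h ℕ.* 2 ℕ.* k} {m = m} L≡[q-1]km

    InFq⇒IsPower : ∀ {x} → InFq q x → ¬ x ≈ 0# → IsPower m x
    InFq⇒IsPower {x} x∈Fq x≉0 = pow[q-1]k≈1⇒IsPower x≉0 (pow≈1⇒pow-*≈1 (h ℕ.* 2) k (InFq⇒pow[q-1]≈1 x∈Fq x≉0))

    IsPower-neg : ∀ {x} → IsPower m x → IsPower m (- x)
    IsPower-neg {x} x-power = IsPower-cong {m} (-1*x≈-x x) (IsPower-* {m} (InFq⇒IsPower (InFq-neg InFq-1) -1≉0) x-power)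
      where
      -1≉0 : ¬ - 1# ≈ 0#
      -1≉0 -1≈0 = 1≉0 (trans (sym (-‿involutive 1#)) (trans (-‿cong -1≈0) -0#≈0#))

    IsPower-swap : ∀ {x y} → IsPower m (x - y) → IsPower m (y - x)
    IsPower-swap {x} {y} x-y-power =
      IsPower-cong {m} (solve 2 (λ x y → :- (x :- y) := y :- x) refl x y) (IsPower-neg x-y-power)

    g : Carrier
    g = pow (pow β (q ℕ.∸ 1)) m

    Q0 : Carrier → Set
    Q0 = InQ0 q m β

    private
      c : ℕ
      c = (q ℕ.∸ 1) ℕ.* m

      swap : ∀ a b c → a ℕ.* b ℕ.* c ≡ a ℕ.* c ℕ.* b
      swap = solve-∀

      L≡ck : L ≡ c ℕ.* k
      L≡ck = ≡.trans L≡[q-1]km (≡.trans (swap (h ℕ.* 2) k m) (≡.cong (λ n → n ℕ.* m ℕ.* k) (≡.sym q-1≡2h)))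

      instance
        c≢0 : NonZero c
        c≢0 = ℕ.m*n≢0⇒m≢0 c {{≡.subst NonZero L≡ck L≢0}}
        k≢0 : NonZero k
        k≢0 = ℕ.m*n≢0⇒n≢0 c {{≡.subst NonZero L≡ck L≢0}}

      g^j≈β^cj : ∀ j → pow g j ≈ pow β (c ℕ.* j)
      g^j≈β^cj j = trans (pow-congˡ j (pow-assocʳ β (q ℕ.∸ 1) m)) (pow-assocʳ β c j)

    g^k≈1 : pow g k ≈ 1#
    g^k≈1 = trans (g^j≈β^cj k) (∣⇒pow-β≈1 (c ℕ.* k) (divides 1 (≡.trans (≡.sym L≡ck) (≡.sym (ℕ.*-identityˡ L)))))

    g^j≈g^[j%k] : ∀ j → pow g j ≈ pow g (j % k)
    g^j≈g^[j%k] j = begin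
      pow g j                                 ≡⟨ ≡.cong (pow g) (m≡m%n+[m/n]*n j k) ⟩
      pow g (j % k ℕ.+ j / k ℕ.* k)           ≈⟨ pow-homo-* g (j % k) _ ⟩
      pow g (j % k) * pow g (j / k ℕ.* k)     ≡⟨ ≡.cong (λ n → pow g (j % k) * pow g n) (ℕ.*-comm (j / k) k) ⟩
      pow g (j % k) * pow g (k ℕ.* (j / k))   ≈⟨ *-congˡ (pow≈1⇒pow-*≈1 k (j / k) g^k≈1) ⟩
      pow g (j % k) * 1#                      ≈⟨ *-identityʳ _ ⟩
      pow g (j % k)                           ∎

    g^-injective : ∀ {i j} → i < k → j < k → pow g i ≈ pow g j → i ≡ j
    g^-injective {i} {j} i<k j<k gⁱ≈gʲ = ℕ.*-cancelˡ-≡ i j c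
      (pow-β-injective (ci<L i<k) (ci<L j<k) (trans (sym (g^j≈β^cj i)) (trans gⁱ≈gʲ (g^j≈β^cj j))))
      where
      ci<L : ∀ {i} → i < k → c ℕ.* i < L
      ci<L {i} i<k = ≡.subst (c ℕ.* i <_) (≡.sym L≡ck) (ℕ.*-monoʳ-< c i<k)

    Q0⇒γ^k≈1 : ∀ {γ} → Q0 γ → pow γ k ≈ 1#
    Q0⇒γ^k≈1 {γ} (j , γ≈gʲ) = begin
      pow γ k          ≈⟨ pow-congˡ k γ≈gʲ ⟩
      pow (pow g j) k  ≈⟨ pow-assocʳ g j k ⟩
      pow g (j ℕ.* k)  ≡⟨ ≡.cong (pow g) (ℕ.*-comm j k) ⟩
      pow g (k ℕ.* j)  ≈⟨ pow≈1⇒pow-*≈1 k j g^k≈1 ⟩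
      1#               ∎

    Q0⇒γ^q*γ≈1 : ∀ {γ} → Q0 γ → pow γ q * γ ≈ 1#
    Q0⇒γ^q*γ≈1 {γ} γ∈Q0 = begin
      pow γ q * γ         ≈⟨ *-congˡ (sym (*-identityʳ γ)) ⟩
      pow γ q * pow γ 1   ≈⟨ sym (pow-homo-* γ q 1) ⟩
      pow γ (q ℕ.+ 1)     ≡⟨ ≡.cong (pow γ) q+1≡km ⟩
      pow γ (k ℕ.* m)     ≈⟨ pow≈1⇒pow-*≈1 k m (Q0⇒γ^k≈1 γ∈Q0) ⟩
      1#                  ∎

    Q0⇒≉0 : ∀ {γ} → Q0 γ → ¬ γ ≈ 0#
    Q0⇒≉0 {γ} γ∈Q0 γ≈0 = 1≉0 (trans (sym (Q0⇒γ^q*γ≈1 γ∈Q0)) (trans (*-congˡ γ≈0) (zeroʳ _)))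

    IsPower⇒pow[q-1]∈Q0 : ∀ {z} → IsPower m z → Q0 (pow z (h ℕ.* 2))
    IsPower⇒pow[q-1]∈Q0 {z} (y , y≉0 , yᵐ≈z) = t , (begin
      pow z (h ℕ.* 2)                   ≈⟨ pow-congˡ (h ℕ.* 2) (trans (sym yᵐ≈z) (pow-congˡ m y≈βᵗ)) ⟩
      pow (pow (pow β t) m) (h ℕ.* 2)   ≈⟨ pow³ t m (h ℕ.* 2) ⟩
      pow β (t ℕ.* m ℕ.* (h ℕ.* 2))     ≡⟨ ≡.cong (pow β) (≡.trans (reverse t m (h ℕ.* 2))
                                              (≡.cong (λ n → n ℕ.* m ℕ.* t) (≡.sym q-1≡2h))) ⟩
      pow β ((q ℕ.∸ 1) ℕ.* m ℕ.* t)     ≈⟨ sym (pow³ (q ℕ.∸ 1) m t) ⟩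
      pow (pow (pow β (q ℕ.∸ 1)) m) t   ∎)
      where
      t : ℕ
      t = proj₁ (discrete-log y y≉0)
      y≈βᵗ : y ≈ pow β t
      y≈βᵗ = proj₂ (discrete-log y y≉0)
      reverse : ∀ t m c → t ℕ.* m ℕ.* c ≡ c ℕ.* m ℕ.* t
      reverse = solve-∀
      pow³ : ∀ a b c → pow (pow (pow β a) b) c ≈ pow β (a ℕ.* b ℕ.* c)
      pow³ a b c = trans (pow-congˡ c (pow-assocʳ β a b)) (pow-assocʳ β (a ℕ.* b) c)

    HasSize-Q0 : HasSize k Q0
    HasSize-Q0 = (λ i → pow g (toℕ i)) ,
      (λ i j gⁱ≈gʲ → Fin.toℕ-injective (g^-injective (Fin.toℕ<n i) (Fin.toℕ<n j) gⁱ≈gʲ)) ,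
      λ γ → (λ { (j , γ≈gʲ) → fromℕ< (m%n<n j k) ,
                   trans (reflexive (≡.cong (pow g) (Fin.toℕ-fromℕ< (m%n<n j k)))) (sym (trans γ≈gʲ (g^j≈g^[j%k] j))) }) ,
            (λ { (i , gⁱ≈γ) → toℕ i , sym gⁱ≈γ })

    IsCPoint⇒InFq×IsPower : ∀ {x} → IsCPoint q m α x → InFq q x × IsPower m (x - α)
    IsCPoint⇒InFq×IsPower {x} ((c₀ , c₀∈Fq , x≈0+c₀) , (a , s , s≉0 , s-power , (c₁ , c₁∈Fq , α≈a+c₁s) , _ , (c₂ , c₂∈Fq , x≈a+c₂s))) =
      x∈Fq , IsPower-cong {m} (sym x-α≈[c₂-c₁]s) (IsPower-* {m} (InFq⇒IsPower (InFq-- c₂∈Fq c₁∈Fq) c₂-c₁≉0) s-power)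
      where
      x∈Fq : InFq q x
      x∈Fq = InFq-cong (sym (trans x≈0+c₀ (trans (+-identityˡ _) (*-identityʳ c₀)))) c₀∈Fq
      x-α≈[c₂-c₁]s : x - α ≈ (c₂ - c₁) * s
      x-α≈[c₂-c₁]s = begin
        x - α                         ≈⟨ +-cong x≈a+c₂s (-‿cong α≈a+c₁s) ⟩
        (a + c₂ * s) - (a + c₁ * s)   ≈⟨ solve 4 (λ a c₁ c₂ s → (a :+ c₂ :* s) :- (a :+ c₁ :* s) := (c₂ :- c₁) :* s) refl a c₁ c₂ s ⟩
        (c₂ - c₁) * s                 ∎
      c₂-c₁≉0 : ¬ c₂ - c₁ ≈ 0#
      c₂-c₁≉0 c₂-c₁≈0 = InFq⇒x-α≉0 x∈Fq (trans x-α≈[c₂-c₁]s (trans (*-congʳ c₂-c₁≈0) (zeroˡ s)))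

    -- The m-ary line through α and x meets the line {c + α} only at α, since α ∉ F_q.
    InFq×IsPower⇒IsCPoint : ∀ {x} → InFq q x → IsPower m (x - α) → IsCPoint q m α x
    InFq×IsPower⇒IsCPoint {x} x∈Fq x-α-power =
      (x , x∈Fq , sym (trans (+-identityˡ _) (*-identityʳ x))) ,
      (α , x - α , InFq⇒x-α≉0 x∈Fq , x-α-power ,
        (0# , InFq-0 , sym (trans (+-congˡ (zeroˡ (x - α))) (+-identityʳ α))) ,
        not-horizontal , x-on-line)
      where
      α+[x-α]≈x : α + (x - α) ≈ x
      α+[x-α]≈x = solve 2 (λ x a → a :+ (x :- a) := x) refl x α
      x-on-line : OnLine q α (x - α) x
      x-on-line = 1# , InFq-1 , sym (trans (+-congˡ (*-identityˡ (x - α))) α+[x-α]≈x)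
      not-horizontal : ¬ SameLine q α (x - α) α 1#
      not-horizontal same = x∉α+Fq (proj₁ (same x) x-on-line)
        where
        x∉α+Fq : ¬ OnLine q α 1# x
        x∉α+Fq (c , c∈Fq , x≈α+c) = α∉Fq (InFq-cong (begin
          x - c              ≈⟨ +-congʳ x≈α+c ⟩
          (α + c * 1#) - c   ≈⟨ solve 2 (λ a c → (a :+ c :* con (+ 1)) :- c := a) refl α c ⟩
          α                  ∎) (InFq-- x∈Fq c∈Fq))

    IsCPoint-cong : ∀ {x y} → x ≈ y → IsCPoint q m α x → IsCPoint q m α y
    IsCPoint-cong x≈y x-cpoint = InFq×IsPower⇒IsCPoint
      (InFq-cong x≈y (proj₁ (IsCPoint⇒InFq×IsPower x-cpoint)))
      (IsPower-cong {m} (+-congʳ x≈y) (proj₂ (IsCPoint⇒InFq×IsPower x-cpoint)))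

    private
      relation-unique : ∀ {γ x y} → ¬ γ ≈ 1# → (x - α) * γ ≈ x + α → (y - α) * γ ≈ y + α → x ≈ y
      relation-unique {γ} {x} {y} γ≉1 x-rel y-rel with zero-product {x - y} {γ - 1#} (begin
        (x - y) * (γ - 1#)                                ≈⟨ solve 4 (λ x y g a → (x :- y) :* (g :- con (+ 1))
                                                               := ((x :- a) :* g :- (x :+ a)) :- ((y :- a) :* g :- (y :+ a))) refl x y γ α ⟩
        ((x - α) * γ - (x + α)) - ((y - α) * γ - (y + α)) ≈⟨ +-cong (x≈y⇒x-y≈0 x-rel) (-‿cong (x≈y⇒x-y≈0 y-rel)) ⟩
        0# - 0#                                           ≈⟨ -‿inverseʳ 0# ⟩
        0#                                                ∎)
      ... | inj₁ x-y≈0 = x-y≈0⇒x≈y x-y≈0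
      ... | inj₂ γ-1≈0 = ⊥-elim (γ≉1 (x-y≈0⇒x≈y γ-1≈0))

      relation-frobenius : ∀ {γ x} → pow γ q * γ ≈ 1# → (x - α) * γ ≈ x + α → (pow x q - α) * γ ≈ pow x q + α
      relation-frobenius {γ} {x} γ^q*γ≈1 x-rel = begin
        (pow x q - α) * γ             ≈⟨ *-congʳ (sym [xᵠ+α]γᵠ≈xᵠ-α) ⟩
        (pow x q + α) * pow γ q * γ   ≈⟨ *-assoc _ _ _ ⟩
        (pow x q + α) * (pow γ q * γ) ≈⟨ *-congˡ γ^q*γ≈1 ⟩
        (pow x q + α) * 1#            ≈⟨ *-identityʳ _ ⟩
        pow x q + α                   ∎
        where
        [xᵠ+α]γᵠ≈xᵠ-α : (pow x q + α) * pow γ q ≈ pow x q - α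
        [xᵠ+α]γᵠ≈xᵠ-α = begin
          (pow x q + α) * pow γ q ≈⟨ *-congʳ (sym (pow-[x-α]-q x)) ⟩
          pow (x - α) q * pow γ q ≈⟨ sym (pow-distrib-* (x - α) γ q) ⟩
          pow ((x - α) * γ) q     ≈⟨ pow-congˡ q x-rel ⟩
          pow (x + α) q           ≈⟨ pow-[x+α]-q x ⟩
          pow x q - α             ∎

      InFq-relation⇒pow[q-1]≈γ : ∀ {γ x} → InFq q x → (x - α) * γ ≈ x + α → pow (x - α) (h ℕ.* 2) ≈ γ
      InFq-relation⇒pow[q-1]≈γ {γ} {x} x∈Fq x-rel = *-cancelˡ (InFq⇒x-α≉0 x∈Fq)
        (trans (sym (pow-q (x - α))) (trans (InFq⇒pow-[x-α]-q x∈Fq) (sym x-rel)))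

    ψ[αγ]-IsCPoint : ∀ {γ} → Q0 γ → ¬ γ ≈ 1# → IsCPoint q m α (ψ (α * γ))
    ψ[αγ]-IsCPoint {γ} γ∈Q0 γ≉1 = InFq×IsPower⇒IsCPoint x∈Fq
      (pow[q-1]k≈1⇒IsPower (InFq⇒x-α≉0 x∈Fq) (begin
        pow (x - α) (h ℕ.* 2 ℕ.* k)        ≈⟨ sym (pow-assocʳ (x - α) (h ℕ.* 2) k) ⟩
        pow (pow (x - α) (h ℕ.* 2)) k      ≈⟨ pow-congˡ k (InFq-relation⇒pow[q-1]≈γ x∈Fq x-rel) ⟩
        pow γ k                            ≈⟨ Q0⇒γ^k≈1 γ∈Q0 ⟩
        1#                                 ∎))
      where
      x : Carrier
      x = ψ (α * γ)
      x-rel : (x - α) * γ ≈ x + α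
      x-rel = Equivalence.to (ψ[αγ]≈x⇔[x-α]γ≈x+α γ≉1) refl
      -- x^q satisfies the same relation as x, which determines x.
      x∈Fq : InFq q x
      x∈Fq = relation-unique γ≉1 (relation-frobenius (Q0⇒γ^q*γ≈1 γ∈Q0) x-rel) x-rel

    IsCPoint⇒ψ-preimage : ∀ {x} → IsCPoint q m α x → ∃ λ γ → Q0 γ × ψ (α * γ) ≈ x
    IsCPoint⇒ψ-preimage {x} x-cpoint =
      γ , IsPower⇒pow[q-1]∈Q0 (proj₂ (IsCPoint⇒InFq×IsPower x-cpoint)) ,
      Equivalence.from (ψ[αγ]≈x⇔[x-α]γ≈x+α γ≉1) x-rel
      where
      x∈Fq : InFq q x
      x∈Fq = proj₁ (IsCPoint⇒InFq×IsPower x-cpoint)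
      γ : Carrier
      γ = pow (x - α) (h ℕ.* 2)
      x-rel : (x - α) * γ ≈ x + α
      x-rel = trans (sym (pow-q (x - α))) (InFq⇒pow-[x-α]-q x∈Fq)
      γ≉1 : ¬ γ ≈ 1#
      γ≉1 γ≈1 = 2α≉0 (begin
        α + α                                      ≈⟨ solve 3 (λ x a g → a :+ a := ((x :+ a) :- (x :- a) :* g) :+ (x :- a) :* (g :- con (+ 1))) refl x α γ ⟩
        ((x + α) - (x - α) * γ) + (x - α) * (γ - 1#) ≈⟨ +-cong (x≈y⇒x-y≈0 (sym x-rel)) (trans (*-congˡ (x≈y⇒x-y≈0 γ≈1)) (zeroʳ _)) ⟩
        0# + 0#                                    ≈⟨ +-identityʳ 0# ⟩
        0#                                         ∎)

    αQ0 : Carrier → Set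
    αQ0 z = ∃ λ γ → Q0 γ × z ≈ α * γ

    S₁ : Carrier → Set
    S₁ z = z ≈ α ⊎ IsCPoint q m α z

    ψ[αQ0]⊆S₁ : ∀ {y} → Image ψ αQ0 y → S₁ y
    ψ[αQ0]⊆S₁ {y} (z , (γ , γ∈Q0 , z≈αγ) , ψz≈y) = by-cases (γ ≟ 1#)
      where
      by-cases : Dec (γ ≈ 1#) → S₁ y
      by-cases (yes γ≈1) = inj₁ (trans (sym ψz≈y) (ψ-≈α (trans z≈αγ (trans (*-congˡ γ≈1) (*-identityʳ α)))))
      by-cases (no  γ≉1) = inj₂ (IsCPoint-cong (trans (sym (ψ-cong z≈αγ)) ψz≈y) (ψ[αγ]-IsCPoint γ∈Q0 γ≉1))

    S₁⊆ψ[αQ0] : ∀ {y} → S₁ y → Image ψ αQ0 y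
    S₁⊆ψ[αQ0] (inj₁ y≈α)      = α , (1# , (0 , refl) , sym (*-identityʳ α)) , trans (ψ-≈α refl) (sym y≈α)
    S₁⊆ψ[αQ0] (inj₂ y-cpoint) =
      let γ , γ∈Q0 , ψ[αγ]≈y = IsCPoint⇒ψ-preimage y-cpoint in α * γ , (γ , γ∈Q0 , refl) , ψ[αγ]≈y

    ψ[αQ0]≐S₁ : SetEq (Image ψ αQ0) S₁
    ψ[αQ0]≐S₁ y = ψ[αQ0]⊆S₁ , S₁⊆ψ[αQ0]

    S₁-clique : IsClique m S₁
    S₁-clique x y (inj₁ x≈α) (inj₁ y≈α) x≉y = ⊥-elim (x≉y (trans x≈α (sym y≈α)))
    S₁-clique x y (inj₁ x≈α) (inj₂ y-cpoint) _ =
      IsPower-cong {m} (+-congʳ (sym x≈α)) (IsPower-swap (proj₂ (IsCPoint⇒InFq×IsPower y-cpoint)))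
    S₁-clique x y (inj₂ x-cpoint) (inj₁ y≈α) _ =
      IsPower-cong {m} (+-congˡ (-‿cong (sym y≈α))) (proj₂ (IsCPoint⇒InFq×IsPower x-cpoint))
    S₁-clique x y (inj₂ x-cpoint) (inj₂ y-cpoint) x≉y = InFq⇒IsPower
      (InFq-- (proj₁ (IsCPoint⇒InFq×IsPower x-cpoint)) (proj₁ (IsCPoint⇒InFq×IsPower y-cpoint)))
      (λ x-y≈0 → x≉y (x-y≈0⇒x≈y x-y≈0))

    HasSize-αQ0 : HasSize k αQ0
    HasSize-αQ0 = HasSize-SetEq (λ z → (λ { (γ , γ∈Q0 , αγ≈z) → γ , γ∈Q0 , sym αγ≈z })
                                      , (λ { (γ , γ∈Q0 , z≈αγ) → γ , γ∈Q0 , sym z≈αγ }))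
                                (HasSize-Image *-congˡ (*-cancelˡ α≉0) HasSize-Q0)

    HasSize-S₁ : HasSize k S₁
    HasSize-S₁ = HasSize-SetEq ψ[αQ0]≐S₁ (HasSize-Image ψ-cong ψ-injective HasSize-αQ0)

    S₂ : Carrier → Set
    S₂ z = (z ≈ α ⊎ z ≈ - α) ⊎ IsCPoint q m α z

    0∪αQ0 : Carrier → Set
    0∪αQ0 z = z ≈ 0# ⊎ αQ0 z

    ψ[0∪αQ0]≐S₂ : SetEq (Image ψ 0∪αQ0) S₂
    ψ[0∪αQ0]≐S₂ y = ⊆S₂ , S₂⊆
      where
      ⊆S₂ : Image ψ 0∪αQ0 y → S₂ y
      ⊆S₂ (z , inj₁ z≈0 , ψz≈y) = inj₁ (inj₂ (trans (sym ψz≈y) (trans (ψ-cong z≈0) ψ-0)))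
      ⊆S₂ (z , inj₂ z∈αQ0 , ψz≈y) = S₁⊆S₂ (ψ[αQ0]⊆S₁ (z , z∈αQ0 , ψz≈y))
        where
        S₁⊆S₂ : S₁ y → S₂ y
        S₁⊆S₂ (inj₁ y≈α)      = inj₁ (inj₁ y≈α)
        S₁⊆S₂ (inj₂ y-cpoint) = inj₂ y-cpoint
      from-αQ0 : Image ψ αQ0 y → Image ψ 0∪αQ0 y
      from-αQ0 (z , z∈αQ0 , ψz≈y) = z , inj₂ z∈αQ0 , ψz≈y
      S₂⊆ : S₂ y → Image ψ 0∪αQ0 y
      S₂⊆ (inj₁ (inj₁ y≈α))  = from-αQ0 (S₁⊆ψ[αQ0] (inj₁ y≈α))
      S₂⊆ (inj₁ (inj₂ y≈-α)) = 0# , inj₁ refl , trans ψ-0 (sym y≈-α)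
      S₂⊆ (inj₂ y-cpoint)    = from-αQ0 (S₁⊆ψ[αQ0] (inj₂ y-cpoint))

    HasSize-S₂ : HasSize (k ℕ.+ 1) S₂
    HasSize-S₂ = ≡.subst (λ n → HasSize n S₂) (ℕ.+-comm 1 k)
      (HasSize-SetEq ψ[0∪αQ0]≐S₂ (HasSize-Image ψ-cong ψ-injective (HasSize-insert 0# αQ0∌0 HasSize-αQ0)))
      where
      αQ0∌0 : ∀ z → αQ0 z → ¬ z ≈ 0#
      αQ0∌0 z (γ , γ∈Q0 , z≈αγ) z≈0 = *-nonzero α≉0 (Q0⇒≉0 γ∈Q0) (trans (sym z≈αγ) z≈0)

    α-IsPower : ∀ j → k ≡ j ℕ.* 2 → IsPower m α
    α-IsPower j k≡2j = pow[q-1]k≈1⇒IsPower α≉0 (begin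
      pow α (h ℕ.* 2 ℕ.* k)         ≈⟨ sym (pow-assocʳ α (h ℕ.* 2) k) ⟩
      pow (pow α (h ℕ.* 2)) k       ≈⟨ pow-congˡ k α^[q-1]≈-1 ⟩
      pow (- 1#) k                  ≡⟨ ≡.cong (pow (- 1#)) (≡.trans k≡2j (ℕ.*-comm j 2)) ⟩
      pow (- 1#) (2 ℕ.* j)          ≈⟨ sym (pow-assocʳ (- 1#) 2 j) ⟩
      pow (pow (- 1#) 2) j          ≈⟨ pow-congˡ j (solve 0 ((:- con (+ 1)) :* ((:- con (+ 1)) :* con (+ 1)) := con (+ 1)) refl) ⟩
      pow 1# j                      ≈⟨ pow-1# j ⟩
      1#                            ∎)
      where
      α^[q-1]≈-1 : pow α (h ℕ.* 2) ≈ - 1#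
      α^[q-1]≈-1 = *-cancelˡ α≉0 (trans (sym (pow-q α))
        (trans α^q≈-α (solve 1 (λ a → :- a := a :* (:- con (+ 1))) refl α)))

    S₂-clique : ∀ j → k ≡ j ℕ.* 2 → IsClique m S₂
    S₂-clique j k≡2j = clique
      where
      α--α-IsPower : IsPower m (α - - α)
      α--α-IsPower = IsPower-cong {m} (solve 1 (λ a → (con (+ 1) :+ con (+ 1)) :* a := a :- (:- a)) refl α)
        (IsPower-* {m} (InFq⇒IsPower (InFq-+ InFq-1 InFq-1) 2≉0) (α-IsPower j k≡2j))
      -- x + α = (x − α)^q is an m-th power with x − α.
      x--α-IsPower : ∀ {x} → IsCPoint q m α x → IsPower m (x - - α)
      x--α-IsPower {x} x-cpoint = IsPower-cong {m}
        (trans (InFq⇒pow-[x-α]-q (proj₁ (IsCPoint⇒InFq×IsPower x-cpoint))) (+-congˡ (sym (-‿involutive α))))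
        (IsPower-pow {m} q (proj₂ (IsCPoint⇒InFq×IsPower x-cpoint)))
      clique : IsClique m S₂
      clique x y (inj₁ (inj₁ x≈α))  (inj₁ (inj₁ y≈α))  x≉y = ⊥-elim (x≉y (trans x≈α (sym y≈α)))
      clique x y (inj₁ (inj₂ x≈-α)) (inj₁ (inj₂ y≈-α)) x≉y = ⊥-elim (x≉y (trans x≈-α (sym y≈-α)))
      clique x y (inj₁ (inj₁ x≈α))  (inj₁ (inj₂ y≈-α)) _ =
        IsPower-cong {m} (+-cong (sym x≈α) (-‿cong (sym y≈-α))) α--α-IsPower
      clique x y (inj₁ (inj₂ x≈-α)) (inj₁ (inj₁ y≈α))  _ =
        IsPower-cong {m} (+-cong (sym x≈-α) (-‿cong (sym y≈α))) (IsPower-swap α--α-IsPower)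
      clique x y (inj₁ (inj₁ x≈α))  (inj₂ y-cpoint)    x≉y = S₁-clique x y (inj₁ x≈α) (inj₂ y-cpoint) x≉y
      clique x y (inj₂ x-cpoint)    (inj₁ (inj₁ y≈α))  x≉y = S₁-clique x y (inj₂ x-cpoint) (inj₁ y≈α) x≉y
      clique x y (inj₂ x-cpoint)    (inj₂ y-cpoint)    x≉y = S₁-clique x y (inj₂ x-cpoint) (inj₂ y-cpoint) x≉y
      clique x y (inj₂ x-cpoint)    (inj₁ (inj₂ y≈-α)) _ =
        IsPower-cong {m} (+-congˡ (-‿cong (sym y≈-α))) (x--α-IsPower x-cpoint)
      clique x y (inj₁ (inj₂ x≈-α)) (inj₂ y-cpoint)    _ =
        IsPower-cong {m} (+-congʳ (sym x≈-α)) (IsPower-swap (x--α-IsPower y-cpoint))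

  module ForOddPrimePower
    (q m p e : ℕ) (p-prime : Prime p) (p≢2 : p ≢ 2) (q≡p^[1+e] : q ≡ p ℕ.^ suc e)
    (m∣q+1 : m ∣ q ℕ.+ 1) (F : IsFiniteFieldOfSize R (q ℕ.* q))
    (d α β : Carrier) (d∈Fq : InFq q d) (d≉0 : ¬ d ≈ 0#) (d-nonsquare : ¬ ∃ λ y → InFq q y × y * y ≈ d)
    (α²≈d : α * α ≈ d) (β-primitive : IsPrimitive (q ℕ.* q) β) where

    open IsFiniteFieldOfSize F
    open FiniteField R F using (size≡pᵉ⇒frobenius; size≡pᵉ∧odd⇒2≉0)

    k : ℕ
    k = _∣_.quotient m∣q+1

    private
      q*q≡p^[2+2e] : q ℕ.* q ≡ p ℕ.^ (suc e ℕ.+ suc e)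
      q*q≡p^[2+2e] = ≡.trans (≡.cong₂ ℕ._*_ q≡p^[1+e] q≡p^[1+e]) (≡.sym (ℕ.^-distribˡ-+-* p (suc e) (suc e)))

      q+1≡km : q ℕ.+ 1 ≡ k ℕ.* m
      q+1≡km = _∣_.equality m∣q+1

      h : ℕ
      h = proj₁ (odd-prime-power {e = e} p-prime p≢2 q≡p^[1+e])

      q≡1+2h : q ≡ suc (h ℕ.* 2)
      q≡1+2h = proj₁ (proj₂ (odd-prime-power {e = e} p-prime p≢2 q≡p^[1+e]))

      instance
        h≢0 : NonZero h
        h≢0 = proj₂ (proj₂ (odd-prime-power {e = e} p-prime p≢2 q≡p^[1+e]))
        m≢0 : NonZero m
        m≢0 = ℕ.m*n≢0⇒n≢0 k {{≡.subst NonZero q+1≡km (≡.subst NonZero (ℕ.+-comm 1 q) _)}}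

      frobenius-q : ∀ x y → pow (x + y) q ≈ pow x q + pow y q
      frobenius-q x y = ≡.subst (λ n → pow (x + y) n ≈ pow x n + pow y n) (≡.sym q≡p^[1+e])
        (size≡pᵉ⇒frobenius {e = suc e ℕ.+ suc e} p-prime q*q≡p^[2+2e] (suc e) x y)

      2≉0 : ¬ 1# + 1# ≈ 0#
      2≉0 = size≡pᵉ∧odd⇒2≉0 {e = suc e ℕ.+ suc e} (prime≢2⇒odd p-prime p≢2) q*q≡p^[2+2e]

    open Construction q m k h q≡1+2h q+1≡km F frobenius-q 2≉0 d α β d∈Fq d≉0 d-nonsquare α²≈d β-primitive public

    m∣[q+1]/2⇒k-even : m ∣ (q ℕ.+ 1) / 2 → ∃ λ j → k ≡ j ℕ.* 2
    m∣[q+1]/2⇒k-even = quotient-even h q≡1+2h q+1≡km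

import Data.Nat as N
open import Data.Nat.Divisibility using (_∤_; module _∣_)

theorem4p18 : (q m : ℕ) → OddPrimePower q → 1 N.< m → (m∣q+1 : m ∣ q N.+ 1) →
  (R : CommutativeRing 0ℓ 0ℓ) → (F : IsFiniteFieldOfSize R (q N.* q)) →
  let open CommutativeRing R
      open FieldNotions R
      open IsFiniteFieldOfSize F
  in (d α β : Carrier) →
     InFq q d → ¬ (d ≈ 0#) → ¬ (∃ λ y → InFq q y × (y * y) ≈ d) →
     (α * α) ≈ d → IsPrimitive (q N.* q) β →
  let open Psi _≟_ inv α d
      αQ0 : Carrier → Set
      αQ0 = λ z → ∃ λ γ → InQ0 q m β γ × z ≈ α * γ
      C : Carrier → Set
      C = IsCPoint q m α
      k : ℕ
      k = _∣_.quotient m∣q+1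
  in (m ∤ (q N.+ 1) N./ 2 →
        let S = λ z → z ≈ α ⊎ C z
        in SetEq (Image ψ αQ0) S × IsClique m S × HasSize k S)
   × (m ∣ (q N.+ 1) N./ 2 →
        let S = λ z → (z ≈ α ⊎ z ≈ - α) ⊎ C z
        in SetEq (Image ψ (λ z → z ≈ 0# ⊎ αQ0 z)) S × IsClique m S × HasSize (k N.+ 1) S)
theorem4p18 q m (p , e , p-prime , p≢2 , q≡p^[1+e]) _ m∣q+1 R F d α β d∈Fq d≉0 d-nonsquare α²≈d β-primitive =
  (λ _ → ψ[αQ0]≐S₁ , S₁-clique , HasSize-S₁) ,
  (λ m∣[q+1]/2 → let j , k≡2j = m∣[q+1]/2⇒k-even m∣[q+1]/2
                 in ψ[0∪αQ0]≐S₂ , S₂-clique j k≡2j , HasSize-S₂)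
  where
  open PaleyClique.ForOddPrimePower R q m p e p-prime p≢2 q≡p^[1+e] m∣q+1 F d α β
    d∈Fq d≉0 d-nonsquare α²≈d β-primitive
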